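{- Let $c,d\geq 1$ be integers. For all integers $b\geq 0$, the lists $\{1^3,2^b,3^c,4^d\}$ and $\{1^4,2^b,3^c,4^d\}$ admit a linear realization.
   Context: The notation $\{1^{a_1},\ldots,t^{a_t}\}$ denotes the multiset with $a_i$ copies of $i$. For a list (multiset) $L$ of positive integers with $|L|$ elements, a linear realization of $L$ is an ordering $[x_0,\ldots,x_{|L|}]$ of $\{0,1,\ldots,|L|\}$ such that the multiset $\{|x_i-x_{i+1}|:0\le i\le |L|-1\}$ equals $L$. -}

module Defs where

open import Data.Nat using (ℕ; zero; suc; _∸_; _⊔_)
open import Data.List using (List; []; _∷_; length; upTo; replicate; _++_)
open import Data.List.Relation.Binary.Permutation.Propositional using (_↭_)
open import Data.Product using (Σ; _×_)

absDiff : ℕ → ℕ → ℕ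
absDiff x y = (x ∸ y) ⊔ (y ∸ x)

diffs : List ℕ → List ℕ
diffs [] = []
diffs (x ∷ []) = []
diffs (x ∷ y ∷ xs) = absDiff x y ∷ diffs (y ∷ xs)

-- A linear realization of a multiset L (given as a list, up to permutation):
-- an ordering xs of {0,1,...,|L|} whose multiset of consecutive absolute
-- differences equals L.
IsLinearRealization : List ℕ → List ℕ → Set
IsLinearRealization L xs = (xs ↭ upTo (suc (length L))) × (diffs xs ↭ L)

HasLinearRealization : List ℕ → Set
HasLinearRealization L = Σ (List ℕ) (IsLinearRealization L)

mset4 : ℕ → ℕ → ℕ → ℕ → List ℕ
mset4 a1 a2 a3 a4 = replicate a1 1 ++ replicate a2 2 ++ replicate a3 3 ++ replicate a4 4

-- The proof grows realizations.  A walk through 0, …, n has a k-cut at t when every edge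
-- crossing t (one end below t, the other not) has length k and the lower ends of the
-- crossing edges are exactly t - k, …, t - 1.  Growing at such a cut, i.e. moving every
-- vertex ≥ t up by k and subdividing each crossing edge x — x + k by the new vertex x + k,
-- gives a walk through 0, …, n + k whose edge lengths are the old ones plus k copies of k
-- (grow-realization).  Afterwards t is again a k-cut (cut-self), and every other cut at
-- distance ≥ k from t survives, moved along with the vertices (cut-lift).
--
-- Hence a realization of {1^a, 2^b, 3^c, 4^d} carrying pairwise apart 2-, 3- and 4-cuts
-- (Growable) yields realizations with b, c, d increased by arbitrary multiples of 2, 3, 4
-- (grow-twos).  Writing b = 2i + r₂, c = 3j + r₃, d = 4l + r₄ with small remainders (split)
-- leaves 280 base cases, a ∈ {3, 4}, r₂ < 4, 1 ≤ r₃ ≤ 5, 1 ≤ r₄ ≤ 7; for each of them a walk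
-- and its cuts are given explicitly and verified by evaluating a decision procedure.

module Submission where

open import Defs
open import Data.Nat using (ℕ; zero; suc; _+_; _*_; _∸_; _≤_; _<_; _≥_; _<ᵇ_; _<?_; _≤?_; _≟_; s≤s; z≤n; ∣_-_∣; NonZero)
open import Data.Nat.Properties
open import Data.Bool using (Bool; true; false; T; if_then_else_; _xor_)
open import Data.List using (List; []; _∷_; [_]; _++_; map; concatMap; length; replicate; upTo; applyUpTo)
import Data.List.Properties as List
open import Data.List.Effectful using (module MonadProperties)
open import Data.List.Relation.Unary.All as All using (All; []; _∷_; all?)
open import Data.List.Relation.Unary.Any using (here; there)
open import Data.List.Membership.Propositional using (_∈_)
open import Data.List.Membership.Propositional.Properties using (∈-upTo⁺; ∈-applyUpTo⁺)
open import Data.List.Sort.InsertionSort.Base ≤-decTotalOrder using (sort)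
open import Data.List.Sort.InsertionSort.Properties ≤-decTotalOrder using (sort-↭)
import Data.List.Relation.Unary.All.Properties as All
open import Data.List.Relation.Binary.Permutation.Propositional
  using (_↭_; ↭-refl; ↭-prep; ↭-trans; ↭-sym; ↭-reflexive; module PermutationReasoning)
import Data.List.Relation.Binary.Permutation.Propositional.Properties as Perm
open import Algebra.Properties.CommutativeSemigroup +-commutativeSemigroup using (xy∙z≈xz∙y; x∙yz≈y∙xz)
open import Data.Maybe as Maybe using (Maybe; just; nothing; is-just)
import Data.Maybe.Relation.Unary.All as MaybeAll
open MaybeAll using (just; nothing) renaming (All to MaybeAll)
open import Data.Product using (_×_; _,_; proj₁; proj₂; ∃₂)
open import Data.Nat.DivMod using (_/_; _%_; m≡m%n+[m/n]*n; m%n<n)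
open import Data.Empty using (⊥-elim)
open import Data.Sum as Sum using (_⊎_; inj₁; inj₂)
open import Data.Unit using (⊤; tt)
open import Function using (_∘_)
open import Relation.Nullary using (Dec; yes; no; contradiction)
open import Relation.Nullary.Decidable using (toWitness; T?; _×-dec_; _⊎-dec_; _→-dec_)
open import Relation.Nullary.Reflects using (ofʸ; ofⁿ)
open import Relation.Binary.PropositionalEquality
  using (_≡_; refl; sym; trans; cong; cong₂; subst)

absDiff≡∣-∣ : ∀ x y → absDiff x y ≡ ∣ x - y ∣
absDiff≡∣-∣ zero    zero    = refl
absDiff≡∣-∣ zero    (suc y) = refl
absDiff≡∣-∣ (suc x) zero    = refl
absDiff≡∣-∣ (suc x) (suc y) = absDiff≡∣-∣ x y

∣-∣-step : ∀ {x y k} → x ≤ y → ∣ x - y ∣ ≡ k → y ≡ x + k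
∣-∣-step {x} x≤y eq = trans (sym (m+[n∸m]≡n x≤y)) (cong (x +_) (trans (sym (m≤n⇒∣m-n∣≡n∸m x≤y)) eq))

∣-∣-shift : ∀ x y k → ∣ x + k - y + k ∣ ≡ ∣ x - y ∣
∣-∣-shift x y k rewrite +-comm x k | +-comm y k = ∣m+n-m+o∣≡∣n-o∣ k x y

-- Walks and their edges

edges : List ℕ → List (ℕ × ℕ)
edges []           = []
edges (x ∷ [])     = []
edges (x ∷ y ∷ xs) = (x , y) ∷ edges (y ∷ xs)

len : ℕ × ℕ → ℕ
len (x , y) = ∣ x - y ∣

diffs≡lengths : ∀ xs → diffs xs ≡ map len (edges xs)
diffs≡lengths []           = refl
diffs≡lengths (x ∷ [])     = refl
diffs≡lengths (x ∷ y ∷ xs) = cong₂ _∷_ (absDiff≡∣-∣ x y) (diffs≡lengths (y ∷ xs))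

edges-glue : ∀ a m b s → edges (a ∷ m ++ b ∷ s) ≡ edges (a ∷ m ++ [ b ]) ++ edges (b ∷ s)
edges-glue a []      b s = refl
edges-glue a (c ∷ m) b s = cong ((a , c) ∷_) (edges-glue c m b s)

concatMap-congᴬ : ∀ {A B : Set} {P : A → Set} {f g : A → List B} →
  (∀ {a} → P a → f a ≡ g a) → ∀ {xs} → All P xs → concatMap f xs ≡ concatMap g xs
concatMap-congᴬ f≡g []         = refl
concatMap-congᴬ f≡g (pa ∷ pxs) = cong₂ _++_ (f≡g pa) (concatMap-congᴬ f≡g pxs)

concatMap-allᴬ : ∀ {A B : Set} {P : A → Set} {Q : B → Set} {f : A → List B} →
  (∀ {a} → P a → All Q (f a)) → ∀ {xs} → All P xs → All Q (concatMap f xs)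
concatMap-allᴬ h pxs = All.concat⁺ (All.map⁺ (All.map h pxs))

concatMap-concatMap : ∀ {A B C : Set} (f : A → List B) (g : B → List C) xs →
  concatMap g (concatMap f xs) ≡ concatMap (concatMap g ∘ f) xs
concatMap-concatMap f g xs = sym (MonadProperties.associative xs f g)

concatMap-∷-↭ : ∀ {A B : Set} (f : A → B) (g : A → List B) xs →
  concatMap (λ a → f a ∷ g a) xs ↭ map f xs ++ concatMap g xs
concatMap-∷-↭ f g []       = ↭-refl
concatMap-∷-↭ f g (x ∷ xs) = ↭-prep (f x) (↭-trans (Perm.++⁺ˡ (g x) (concatMap-∷-↭ f g xs))
                                                (Perm.shifts (g x) (map f xs)))

map-const : ∀ {A : Set} (k : ℕ) (xs : List A) → map (λ _ → k) xs ≡ replicate (length xs) k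
map-const k []       = refl
map-const k (x ∷ xs) = cong (k ∷_) (map-const k xs)

applyUpTo-+ : ∀ {A : Set} (f : ℕ → A) m n → applyUpTo f (m + n) ≡ applyUpTo f m ++ applyUpTo (f ∘ (m +_)) n
applyUpTo-+ f zero    n = refl
applyUpTo-+ f (suc m) n = cong (f 0 ∷_) (applyUpTo-+ (f ∘ suc) m n)

applyUpTo-cong : ∀ {A : Set} {f g : ℕ → A} n → (∀ {i} → i < n → f i ≡ g i) → applyUpTo f n ≡ applyUpTo g n
applyUpTo-cong zero    f≡g = refl
applyUpTo-cong (suc n) f≡g = cong₂ _∷_ (f≡g (s≤s z≤n)) (applyUpTo-cong n (f≡g ∘ s≤s))

-- Crossing a threshold

<ᵇ-true : ∀ {x t} → x < t → (x <ᵇ t) ≡ true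
<ᵇ-true {x} {t} x<t with x <ᵇ t | <ᵇ-reflects-< x t
... | true  | _        = refl
... | false | ofⁿ x≮t = contradiction x<t x≮t

<ᵇ-false : ∀ {x t} → t ≤ x → (x <ᵇ t) ≡ false
<ᵇ-false {x} {t} t≤x with x <ᵇ t | <ᵇ-reflects-< x t
... | true  | ofʸ x<t = contradiction t≤x (<⇒≱ x<t)
... | false | _       = refl

<ᵇ-shift : ∀ x t k → (x + k <ᵇ t + k) ≡ (x <ᵇ t)
<ᵇ-shift x t k with x <ᵇ t | <ᵇ-reflects-< x t
... | true  | ofʸ x<t = <ᵇ-true (+-monoˡ-< k x<t)
... | false | ofⁿ x≮t = <ᵇ-false (+-monoˡ-≤ k (≮⇒≥ x≮t))

-- lift k t x: values below t stay, the others move up by k, opening the gap [t, t + k)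
lift : ℕ → ℕ → ℕ → ℕ
lift k t x = if x <ᵇ t then x else x + k

lift-low : ∀ {k t x} → x < t → lift k t x ≡ x
lift-low x<t rewrite <ᵇ-true x<t = refl

lift-high : ∀ {k t x} → t ≤ x → lift k t x ≡ x + k
lift-high t≤x rewrite <ᵇ-false t≤x = refl

crosses : ℕ → ℕ × ℕ → Bool
crosses t (x , y) = (x <ᵇ t) xor (y <ᵇ t)

crossing : ℕ → ℕ × ℕ → List ℕ
crossing t (x , y) =
  if x <ᵇ t then (if y <ᵇ t then [] else [ x ])
            else (if y <ᵇ t then [ y ] else [])

crossings : ℕ → List ℕ → List ℕ
crossings t xs = concatMap (crossing t) (edges xs)

Fits : ℕ → ℕ → ℕ × ℕ → Set
Fits k t e = T (crosses t e) → len e ≡ k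

module _ {t x y : ℕ} where

  crossing-low : x < t → y < t → crossing t (x , y) ≡ []
  crossing-low x<t y<t rewrite <ᵇ-true x<t | <ᵇ-true y<t = refl

  crossing-high : t ≤ x → t ≤ y → crossing t (x , y) ≡ []
  crossing-high t≤x t≤y rewrite <ᵇ-false t≤x | <ᵇ-false t≤y = refl

  crossing-up : x < t → t ≤ y → crossing t (x , y) ≡ [ x ]
  crossing-up x<t t≤y rewrite <ᵇ-true x<t | <ᵇ-false t≤y = refl

  crossing-down : t ≤ x → y < t → crossing t (x , y) ≡ [ y ]
  crossing-down t≤x y<t rewrite <ᵇ-false t≤x | <ᵇ-true y<t = refl

  fits-low : ∀ {k} → x < t → y < t → Fits k t (x , y)
  fits-low x<t y<t rewrite <ᵇ-true x<t | <ᵇ-true y<t = λ ()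

  fits-high : ∀ {k} → t ≤ x → t ≤ y → Fits k t (x , y)
  fits-high t≤x t≤y rewrite <ᵇ-false t≤x | <ᵇ-false t≤y = λ ()

crossing-shift : ∀ t x y k → crossing (t + k) (x + k , y + k) ≡ map (_+ k) (crossing t (x , y))
crossing-shift t x y k rewrite <ᵇ-shift x t k | <ᵇ-shift y t k with x <ᵇ t | y <ᵇ t
... | true  | true  = refl
... | true  | false = refl
... | false | true  = refl
... | false | false = refl

fits-shift : ∀ {k'} t x y k → Fits k' t (x , y) → Fits k' (t + k) (x + k , y + k)
fits-shift t x y k fit rewrite <ᵇ-shift x t k | <ᵇ-shift y t k | ∣-∣-shift x y k = fit

data Position (k t x y : ℕ) : Set where
  below    : x < t → y < t → Position k t x y
  above    : t ≤ x → t ≤ y → Position k t x y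
  upward   : x < t → t ≤ y → y ≡ x + k → Position k t x y
  downward : y < t → t ≤ x → x ≡ y + k → Position k t x y

position : ∀ {k t e} → Fits k t e → Position k t (proj₁ e) (proj₂ e)
position {k} {t} {x , y} fit with x <ᵇ t | <ᵇ-reflects-< x t | y <ᵇ t | <ᵇ-reflects-< y t
... | true  | ofʸ x<t | true  | ofʸ y<t = below x<t y<t
... | false | ofⁿ x≮t | false | ofⁿ y≮t = above (≮⇒≥ x≮t) (≮⇒≥ y≮t)
... | true  | ofʸ x<t | false | ofⁿ y≮t = upward x<t (≮⇒≥ y≮t) (∣-∣-step (<⇒≤ (<-≤-trans x<t (≮⇒≥ y≮t))) (fit tt))
... | false | ofⁿ x≮t | true  | ofʸ y<t =
  downward y<t (≮⇒≥ x≮t) (∣-∣-step (<⇒≤ (<-≤-trans y<t (≮⇒≥ x≮t))) (trans (∣-∣-comm y x) (fit tt)))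

-- Growing a walk at a threshold

-- the stretch of the grown walk that replaces the edge (x , y)
segment : ℕ → ℕ → ℕ × ℕ → List ℕ
segment k t (x , y) = lift k t x ∷ map (_+ k) (crossing t (x , y)) ++ [ lift k t y ]

-- the grown walk after its vertex x, when the original walk continues with ys
grow-from : ℕ → ℕ → ℕ → List ℕ → List ℕ
grow-from k t x []       = []
grow-from k t x (y ∷ ys) = map (_+ k) (crossing t (x , y)) ++ lift k t y ∷ grow-from k t y ys

grow : ℕ → ℕ → List ℕ → List ℕ
grow k t []       = []
grow k t (x ∷ xs) = lift k t x ∷ grow-from k t x xs

edges-grow : ∀ k t xs → edges (grow k t xs) ≡ concatMap (edges ∘ segment k t) (edges xs)
edges-grow k t []           = refl
edges-grow k t (x ∷ [])     = refl
edges-grow k t (x ∷ y ∷ ys) =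
  trans (edges-glue (lift k t x) (map (_+ k) (crossing t (x , y))) (lift k t y) (grow-from k t y ys))
        (cong (edges (segment k t (x , y)) ++_) (edges-grow k t (y ∷ ys)))

grow-↭ : ∀ k t xs → grow k t xs ↭ map (lift k t) xs ++ map (_+ k) (crossings t xs)
grow-↭ k t []       = ↭-refl
grow-↭ k t (x ∷ xs) = ↭-prep (lift k t x) (from x xs)
  where
  open PermutationReasoning
  from : ∀ x ys → grow-from k t x ys ↭ map (lift k t) ys ++ map (_+ k) (crossings t (x ∷ ys))
  from x []       = ↭-refl
  from x (y ∷ ys) = begin
    new ++ lift k t y ∷ grow-from k t y ys
      ↭⟨ Perm.++⁺ˡ new (↭-prep (lift k t y) (from y ys)) ⟩
    new ++ lift k t y ∷ map (lift k t) ys ++ map (_+ k) (crossings t (y ∷ ys))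
      ↭⟨ Perm.shifts new (lift k t y ∷ map (lift k t) ys) ⟩
    lift k t y ∷ map (lift k t) ys ++ new ++ map (_+ k) (crossings t (y ∷ ys))
      ≡⟨ cong (λ zs → lift k t y ∷ map (lift k t) ys ++ zs)
              (sym (List.map-++ (_+ k) (crossing t (x , y)) (crossings t (y ∷ ys)))) ⟩
    lift k t y ∷ map (lift k t) ys ++ map (_+ k) (crossings t (x ∷ y ∷ ys)) ∎
    where new = map (_+ k) (crossing t (x , y))

module _ {k t : ℕ} where

  segment-below : ∀ {x y} → x < t → y < t → segment k t (x , y) ≡ x ∷ y ∷ []
  segment-below x<t y<t rewrite lift-low {k} x<t | lift-low {k} y<t | crossing-low x<t y<t = refl

  segment-above : ∀ {x y} → t ≤ x → t ≤ y → segment k t (x , y) ≡ x + k ∷ y + k ∷ []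
  segment-above t≤x t≤y rewrite lift-high {k} t≤x | lift-high {k} t≤y | crossing-high t≤x t≤y = refl

  segment-upward : ∀ {x} → x < t → t ≤ x + k → segment k t (x , x + k) ≡ x ∷ x + k ∷ x + k + k ∷ []
  segment-upward x<t t≤y rewrite lift-low {k} x<t | lift-high {k} t≤y | crossing-up x<t t≤y = refl

  segment-downward : ∀ {y} → y < t → t ≤ y + k → segment k t (y + k , y) ≡ y + k + k ∷ y + k ∷ y ∷ []
  segment-downward y<t t≤x rewrite lift-high {k} t≤x | lift-low {k} y<t | crossing-down t≤x y<t = refl

segment-lengths : ∀ {k t x y} → Position k t x y →
  map len (edges (segment k t (x , y))) ≡ len (x , y) ∷ map (λ _ → k) (crossing t (x , y))
segment-lengths {k} (below x<t y<t)
  rewrite segment-below {k} x<t y<t | crossing-low x<t y<t = refl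
segment-lengths {k} {x = x} {y} (above t≤x t≤y)
  rewrite segment-above {k} t≤x t≤y | crossing-high t≤x t≤y | ∣-∣-shift x y k = refl
segment-lengths {k} {x = x} (upward x<t t≤y refl)
  rewrite segment-upward x<t t≤y | crossing-up x<t t≤y | ∣m-m+n∣≡n (x + k) k = refl
segment-lengths {k} {y = y} (downward y<t t≤x refl)
  rewrite segment-downward y<t t≤x | crossing-down t≤x y<t
    | ∣-∣-comm (y + k + k) (y + k) | ∣m-m+n∣≡n (y + k) k | ∣-∣-comm (y + k) y | ∣m-m+n∣≡n y k = refl

segment-crossings-self : ∀ {k t x y} → Position k t x y → crossings t (segment k t (x , y)) ≡ crossing t (x , y)
segment-crossings-self {k} (below x<t y<t)
  rewrite segment-below {k} x<t y<t | crossing-low x<t y<t = refl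
segment-crossings-self {k} {x = x} {y} (above t≤x t≤y)
  rewrite segment-above {k} t≤x t≤y | crossing-high t≤x t≤y
    | crossing-high (≤-trans t≤x (m≤m+n x k)) (≤-trans t≤y (m≤m+n y k)) = refl
segment-crossings-self {k} {x = x} (upward x<t t≤y refl)
  rewrite segment-upward x<t t≤y | crossing-up x<t t≤y
    | crossing-high t≤y (≤-trans t≤y (m≤m+n (x + k) k)) = refl
segment-crossings-self {k} {y = y} (downward y<t t≤x refl)
  rewrite segment-downward y<t t≤x | crossing-down t≤x y<t
    | crossing-high (≤-trans t≤x (m≤m+n (y + k) k)) t≤x = refl

segment-fits-self : ∀ {k t x y} → Position k t x y → All (Fits k t) (edges (segment k t (x , y)))
segment-fits-self {k} (below x<t y<t)
  rewrite segment-below {k} x<t y<t = fits-low x<t y<t ∷ []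
segment-fits-self {k} {x = x} {y} (above t≤x t≤y)
  rewrite segment-above {k} t≤x t≤y = fits-high (≤-trans t≤x (m≤m+n x k)) (≤-trans t≤y (m≤m+n y k)) ∷ []
segment-fits-self {k} {x = x} (upward x<t t≤y refl)
  rewrite segment-upward x<t t≤y =
    (λ _ → ∣m-m+n∣≡n x k) ∷ fits-high t≤y (≤-trans t≤y (m≤m+n (x + k) k)) ∷ []
segment-fits-self {k} {y = y} (downward y<t t≤x refl)
  rewrite segment-downward y<t t≤x =
    fits-high (≤-trans t≤x (m≤m+n (y + k) k)) t≤x ∷ (λ _ → trans (∣-∣-comm (y + k) y) (∣m-m+n∣≡n y k)) ∷ []

module _ {k t t' : ℕ} (t'+k≤t : t' + k ≤ t) where

  private
    t'≤t : t' ≤ t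
    t'≤t = m+n≤o⇒m≤o t' t'+k≤t

    t'≤low : ∀ {z} → t ≤ z + k → t' ≤ z
    t'≤low t≤z+k = +-cancelʳ-≤ k t' _ (≤-trans t'+k≤t t≤z+k)

    t'≤ : ∀ {z} → t ≤ z → t' ≤ z
    t'≤ = ≤-trans t'≤t

    up : ∀ {z} j → t' ≤ z → t' ≤ z + j
    up j t'≤z = ≤-trans t'≤z (m≤m+n _ j)

  segment-crossings-below : ∀ {x y} → Position k t x y → crossings t' (segment k t (x , y)) ≡ crossing t' (x , y)
  segment-crossings-below (below x<t y<t) rewrite segment-below {k} x<t y<t = List.++-identityʳ _
  segment-crossings-below (above t≤x t≤y) rewrite segment-above {k} t≤x t≤y
    | crossing-high (up k (t'≤ t≤x)) (up k (t'≤ t≤y)) | crossing-high (t'≤ t≤x) (t'≤ t≤y) = refl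
  segment-crossings-below (upward x<t t≤y refl) rewrite segment-upward x<t t≤y
    | crossing-high (t'≤low t≤y) (up k (t'≤low t≤y))
    | crossing-high (up k (t'≤low t≤y)) (up k (up k (t'≤low t≤y))) = refl
  segment-crossings-below (downward y<t t≤x refl) rewrite segment-downward y<t t≤x
    | crossing-high (up k (t'≤low t≤x)) (t'≤low t≤x)
    | crossing-high (up k (up k (t'≤low t≤x))) (up k (t'≤low t≤x)) = refl

  segment-fits-below : ∀ {k' x y} → Position k t x y → Fits k' t' (x , y) → All (Fits k' t') (edges (segment k t (x , y)))
  segment-fits-below (below x<t y<t) fit rewrite segment-below {k} x<t y<t = fit ∷ []
  segment-fits-below (above t≤x t≤y) fit rewrite segment-above {k} t≤x t≤y =
    fits-high (up k (t'≤ t≤x)) (up k (t'≤ t≤y)) ∷ []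
  segment-fits-below (upward x<t t≤y refl) fit rewrite segment-upward x<t t≤y =
    fits-high (t'≤low t≤y) (up k (t'≤low t≤y)) ∷ fits-high (up k (t'≤low t≤y)) (up k (up k (t'≤low t≤y))) ∷ []
  segment-fits-below (downward y<t t≤x refl) fit rewrite segment-downward y<t t≤x =
    fits-high (up k (up k (t'≤low t≤x))) (up k (t'≤low t≤x)) ∷ fits-high (up k (t'≤low t≤x)) (t'≤low t≤x) ∷ []

module _ {k t t' : ℕ} (t+k≤t' : t + k ≤ t') where

  private
    shifted : ∀ {z} → z < t → z + k < t'
    shifted z<t = <-≤-trans (+-monoˡ-< k z<t) t+k≤t'

    low : ∀ {z} → z < t → z < t'
    low {z} z<t = ≤-<-trans (m≤m+n z k) (shifted z<t)

    lowk : ∀ {z} → z < t' → z < t' + k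
    lowk z<t' = <-≤-trans z<t' (m≤m+n _ k)

  segment-crossings-above : ∀ {x y} → Position k t x y →
    crossings (t' + k) (segment k t (x , y)) ≡ map (_+ k) (crossing t' (x , y))
  segment-crossings-above (below x<t y<t) rewrite segment-below {k} x<t y<t
    | crossing-low (lowk (low x<t)) (lowk (low y<t)) | crossing-low (low x<t) (low y<t) = refl
  segment-crossings-above {x} {y} (above t≤x t≤y) rewrite segment-above {k} t≤x t≤y =
    trans (List.++-identityʳ _) (crossing-shift t' x y k)
  segment-crossings-above (upward x<t t≤y refl) rewrite segment-upward x<t t≤y
    | crossing-low (lowk (low x<t)) (lowk (shifted x<t)) | crossing-low (lowk (shifted x<t)) (+-monoˡ-< k (shifted x<t))
    | crossing-low (low x<t) (shifted x<t) = refl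
  segment-crossings-above (downward y<t t≤x refl) rewrite segment-downward y<t t≤x
    | crossing-low (+-monoˡ-< k (shifted y<t)) (lowk (shifted y<t)) | crossing-low (lowk (shifted y<t)) (lowk (low y<t))
    | crossing-low (shifted y<t) (low y<t) = refl

  segment-fits-above : ∀ {k' x y} → Position k t x y → Fits k' t' (x , y) →
    All (Fits k' (t' + k)) (edges (segment k t (x , y)))
  segment-fits-above (below x<t y<t) fit rewrite segment-below {k} x<t y<t =
    fits-low (lowk (low x<t)) (lowk (low y<t)) ∷ []
  segment-fits-above {x = x} {y} (above t≤x t≤y) fit rewrite segment-above {k} t≤x t≤y = fits-shift t' x y k fit ∷ []
  segment-fits-above (upward x<t t≤y refl) fit rewrite segment-upward x<t t≤y =
    fits-low (lowk (low x<t)) (lowk (shifted x<t)) ∷ fits-low (lowk (shifted x<t)) (+-monoˡ-< k (shifted x<t)) ∷ []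
  segment-fits-above (downward y<t t≤x refl) fit rewrite segment-downward y<t t≤x =
    fits-low (+-monoˡ-< k (shifted y<t)) (lowk (shifted y<t)) ∷ fits-low (lowk (shifted y<t)) (lowk (low y<t)) ∷ []

-- Cuts

window : ℕ → ℕ → List ℕ
window k t = applyUpTo ((t ∸ k) +_) k

record Cut (k t : ℕ) (xs : List ℕ) : Set where
  field
    k≤t       : k ≤ t
    t≤length  : t ≤ length xs
    fits      : All (Fits k t) (edges xs)
    crossings↭ : crossings t xs ↭ window k t

open Cut

length-crossings : ∀ {k t xs} → Cut k t xs → length (crossings t xs) ≡ k
length-crossings {k} {t} cut = trans (Perm.↭-length (crossings↭ cut)) (List.length-applyUpTo _ k)

lift-range : ∀ {k t M} → k ≤ t → t ≤ M → map (lift k t) (upTo M) ++ map (_+ k) (window k t) ↭ upTo (M + k)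
lift-range {k} {t} {M} k≤t t≤M =
  subst (λ M → map (lift k t) (upTo M) ++ map (_+ k) (window k t) ↭ upTo (M + k))
        (m+[n∸m]≡n t≤M) (from-t (M ∸ t))
  where
  open PermutationReasoning
  gap : map (_+ k) (window k t) ≡ applyUpTo (t +_) k
  gap = trans (List.map-applyUpTo _ (_+ k) k)
              (applyUpTo-cong k (λ {i} _ → trans (xy∙z≈xz∙y (t ∸ k) i k) (cong (_+ i) (m∸n+n≡m k≤t))))
  from-t : ∀ m → map (lift k t) (upTo (t + m)) ++ map (_+ k) (window k t) ↭ upTo (t + m + k)
  from-t m = begin
    map (lift k t) (upTo (t + m)) ++ map (_+ k) (window k t) ≡⟨ cong₂ _++_ lifted gap ⟩
    (upTo t ++ moved) ++ applyUpTo (t +_) k                  ≡⟨ List.++-assoc (upTo t) moved _ ⟩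
    upTo t ++ moved ++ applyUpTo (t +_) k                    ↭⟨ Perm.++⁺ˡ (upTo t) (Perm.++-comm moved _) ⟩
    upTo t ++ applyUpTo (t +_) k ++ moved                    ≡⟨ sym whole ⟩
    upTo (t + m + k)                                         ∎
    where
    moved = applyUpTo (λ i → t + i + k) m
    lifted : map (lift k t) (upTo (t + m)) ≡ upTo t ++ moved
    lifted = trans (List.map-upTo (lift k t) (t + m))
             (trans (applyUpTo-+ (lift k t) t m)
                    (cong₂ _++_ (applyUpTo-cong t lift-low) (applyUpTo-cong m (λ _ → lift-high (m≤m+n t _)))))
    whole : upTo (t + m + k) ≡ upTo t ++ applyUpTo (t +_) k ++ moved
    whole = trans (cong upTo (trans (+-assoc t m k) (cong (t +_) (+-comm m k))))
            (trans (applyUpTo-+ (λ i → i) t (k + m))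
                   (cong (upTo t ++_) (trans (applyUpTo-+ (t +_) k m)
                     (cong (applyUpTo (t +_) k ++_)
                       (applyUpTo-cong m (λ {i} _ → trans (cong (t +_) (+-comm k i)) (sym (+-assoc t i k))))))))

module _ {k t : ℕ} {xs : List ℕ} (cut : Cut k t xs) where

  grow-length : length (grow k t xs) ≡ length xs + k
  grow-length = trans (Perm.↭-length (grow-↭ k t xs))
    (trans (List.length-++ (map (lift k t) xs))
           (cong₂ _+_ (List.length-map (lift k t) xs)
                      (trans (List.length-map (_+ k) (crossings t xs)) (length-crossings cut))))

  grow-vertices : ∀ {M} → xs ↭ upTo M → grow k t xs ↭ upTo (M + k)
  grow-vertices {M} xs↭ = ↭-trans (grow-↭ k t xs)
    (↭-trans (Perm.++⁺ (Perm.map⁺ (lift k t) xs↭) (Perm.map⁺ (_+ k) (crossings↭ cut)))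
             (lift-range (k≤t cut) t≤M))
    where
    t≤M : t ≤ M
    t≤M = subst (t ≤_) (trans (Perm.↭-length xs↭) (List.length-upTo M)) (t≤length cut)

  grow-lengths : map len (edges (grow k t xs)) ↭ map len (edges xs) ++ replicate k k
  grow-lengths = begin
    map len (edges (grow k t xs))
      ≡⟨ cong (map len) (edges-grow k t xs) ⟩
    map len (concatMap (edges ∘ segment k t) (edges xs))
      ≡⟨ List.map-concatMap len (edges ∘ segment k t) (edges xs) ⟩
    concatMap (map len ∘ edges ∘ segment k t) (edges xs)
      ≡⟨ concatMap-congᴬ (λ fit → segment-lengths (position {k} {t} fit)) (fits cut) ⟩
    concatMap (λ e → len e ∷ map (λ _ → k) (crossing t e)) (edges xs)
      ↭⟨ concatMap-∷-↭ len (map (λ _ → k) ∘ crossing t) (edges xs) ⟩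
    map len (edges xs) ++ concatMap (map (λ _ → k) ∘ crossing t) (edges xs)
      ≡⟨ cong (map len (edges xs) ++_) (sym (List.map-concatMap (λ _ → k) (crossing t) (edges xs))) ⟩
    map len (edges xs) ++ map (λ _ → k) (crossings t xs)
      ≡⟨ cong (map len (edges xs) ++_) (trans (map-const k (crossings t xs))
                                              (cong (λ n → replicate n k) (length-crossings cut))) ⟩
    map len (edges xs) ++ replicate k k ∎
    where open PermutationReasoning

  grow-realization : ∀ {L} → IsLinearRealization L xs → IsLinearRealization (L ++ replicate k k) (grow k t xs)
  grow-realization {L} (vertices , lengths) =
    subst (λ n → grow k t xs ↭ upTo (suc n)) (sym size) (grow-vertices vertices) ,
    ↭-trans (↭-reflexive (diffs≡lengths (grow k t xs)))
      (↭-trans grow-lengths (Perm.++⁺ʳ (replicate k k) (↭-trans (↭-reflexive (sym (diffs≡lengths xs))) lengths)))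
    where
    size : length (L ++ replicate k k) ≡ length L + k
    size = trans (List.length-++ L) (cong (length L +_) (List.length-replicate k))

  private
    crossings-grow : ∀ s → crossings s (grow k t xs) ≡ concatMap (crossings s ∘ segment k t) (edges xs)
    crossings-grow s = trans (cong (concatMap (crossing s)) (edges-grow k t xs))
                             (concatMap-concatMap (edges ∘ segment k t) (crossing s) (edges xs))

    fits-grow : ∀ k' s {P : ℕ × ℕ → Set} → All P (edges xs) →
      (∀ {e} → P e → All (Fits k' s) (edges (segment k t e))) → All (Fits k' s) (edges (grow k t xs))
    fits-grow k' s ps h = subst (All _) (sym (edges-grow k t xs)) (concatMap-allᴬ h ps)

    longer : ∀ {s} → s ≤ length xs → s ≤ length (grow k t xs)
    longer s≤ = ≤-trans s≤ (subst (length xs ≤_) (sym grow-length) (m≤m+n (length xs) k))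

  cut-self : Cut k t (grow k t xs)
  cut-self = record
    { k≤t        = k≤t cut
    ; t≤length   = longer (t≤length cut)
    ; fits       = fits-grow k t (fits cut) (λ fit → segment-fits-self (position {k} {t} fit))
    ; crossings↭ = ↭-trans (↭-reflexive (trans (crossings-grow t)
                     (concatMap-congᴬ (λ fit → segment-crossings-self (position {k} {t} fit)) (fits cut))))
                     (crossings↭ cut)
    }

  cut-below : ∀ {k' t'} → t' + k ≤ t → Cut k' t' xs → Cut k' t' (grow k t xs)
  cut-below {k'} {t'} t'+k≤t cut' = record
    { k≤t        = k≤t cut'
    ; t≤length   = longer (t≤length cut')
    ; fits       = fits-grow k' t' (All.zip (fits cut , fits cut'))
                     (λ (fit , fit') → segment-fits-below t'+k≤t (position {k} {t} fit) fit')
    ; crossings↭ = ↭-trans (↭-reflexive (trans (crossings-grow t')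
                     (concatMap-congᴬ (λ fit → segment-crossings-below t'+k≤t (position {k} {t} fit)) (fits cut))))
                     (crossings↭ cut')
    }

  cut-above : ∀ {k' t'} → t + k ≤ t' → Cut k' t' xs → Cut k' (t' + k) (grow k t xs)
  cut-above {k'} {t'} t+k≤t' cut' = record
    { k≤t        = ≤-trans (k≤t cut') (m≤m+n t' k)
    ; t≤length   = subst (t' + k ≤_) (sym grow-length) (+-monoˡ-≤ k (t≤length cut'))
    ; fits       = fits-grow k' (t' + k) (All.zip (fits cut , fits cut'))
                     (λ (fit , fit') → segment-fits-above t+k≤t' (position {k} {t} fit) fit')
    ; crossings↭ = begin
        crossings (t' + k) (grow k t xs)
          ≡⟨ crossings-grow (t' + k) ⟩
        concatMap (crossings (t' + k) ∘ segment k t) (edges xs)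
          ≡⟨ concatMap-congᴬ (λ fit → segment-crossings-above t+k≤t' (position {k} {t} fit)) (fits cut) ⟩
        concatMap (map (_+ k) ∘ crossing t') (edges xs)
          ≡⟨ sym (List.map-concatMap (_+ k) (crossing t') (edges xs)) ⟩
        map (_+ k) (crossings t' xs)
          ↭⟨ Perm.map⁺ (_+ k) (crossings↭ cut') ⟩
        map (_+ k) (window k' t')
          ≡⟨ window-shift ⟩
        window k' (t' + k) ∎
    }
    where
    open PermutationReasoning
    window-shift : map (_+ k) (window k' t') ≡ window k' (t' + k)
    window-shift = trans (List.map-applyUpTo _ (_+ k) k')
      (applyUpTo-cong k' (λ {i} _ → trans (xy∙z≈xz∙y (t' ∸ k') i k) (cong (_+ i) (sym (+-∸-comm k (k≤t cut'))))))

-- Several cuts at once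

Apart : ℕ → ℕ → ℕ → Set
Apart k t t' = t' + k ≤ t ⊎ t + k ≤ t'

cut-lift : ∀ {k k' t t' xs} → 0 < k → Apart k t t' → Cut k t xs → Cut k' t' xs →
  Cut k' (lift k t t') (grow k t xs)
cut-lift {k} {k'} {t} {t'} {xs} 0<k (inj₁ t'+k≤t) cut cut' =
  subst (λ s → Cut k' s (grow k t xs)) (sym (lift-low (<-≤-trans (m<m+n t' 0<k) t'+k≤t))) (cut-below cut t'+k≤t cut')
cut-lift {k} {k'} {t} {t'} {xs} 0<k (inj₂ t+k≤t') cut cut' =
  subst (λ s → Cut k' s (grow k t xs)) (sym (lift-high (m+n≤o⇒m≤o t t+k≤t'))) (cut-above cut t+k≤t' cut')

lift-expands : ∀ {k t u v} j → u + j ≤ v → lift k t u + j ≤ lift k t v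
lift-expands {k} {t} {u} {v} j u+j≤v with u <? t | v <? t
... | yes u<t | yes v<t rewrite lift-low {k} u<t | lift-low {k} v<t = u+j≤v
... | yes u<t | no  v≮t rewrite lift-low {k} u<t | lift-high {k} (≮⇒≥ v≮t) = ≤-trans u+j≤v (m≤m+n v k)
... | no  u≮t | yes v<t = contradiction (≤-<-trans (≤-trans (≮⇒≥ u≮t) (m+n≤o⇒m≤o u u+j≤v)) v<t) (<-irrefl refl)
... | no  u≮t | no  v≮t rewrite lift-high {k} (≮⇒≥ u≮t) | lift-high {k} (≮⇒≥ v≮t) =
  subst (_≤ v + k) (xy∙z≈xz∙y u j k) (+-monoˡ-≤ k u+j≤v)

apart-lift : ∀ {k' u v} k t → Apart k' u v → Apart k' (lift k t u) (lift k t v)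
apart-lift {k'} k t = Sum.map (lift-expands {k} {t} k') (lift-expands {k} {t} k')

apart-self : ∀ {k t t'} → 0 < k → Apart k t t' → Apart k t (lift k t t')
apart-self {k} {t} {t'} 0<k (inj₁ t'+k≤t) rewrite lift-low {k} (<-≤-trans (m<m+n t' 0<k) t'+k≤t) = inj₁ t'+k≤t
apart-self {k} {t} {t'} 0<k (inj₂ t+k≤t') rewrite lift-high {k} (m+n≤o⇒m≤o t t+k≤t') = inj₂ (≤-trans t+k≤t' (m≤m+n t' k))

-- Realizations of {1^a, 2^b, 3^c, 4^d} that can keep growing

realization-↭ : ∀ {L L' xs} → L ↭ L' → IsLinearRealization L xs → IsLinearRealization L' xs
realization-↭ L↭L' (vertices , lengths) =
  subst (λ n → _ ↭ upTo (suc n)) (Perm.↭-length L↭L') vertices , ↭-trans lengths L↭L'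

++-move : ∀ (xs ys zs : List ℕ) → (xs ++ ys) ++ zs ↭ xs ++ zs ++ ys
++-move xs ys zs = ↭-trans (↭-reflexive (List.++-assoc xs ys zs)) (Perm.++⁺ˡ xs (Perm.++-comm ys zs))

more-twos : ∀ a b c d → mset4 a b c d ++ replicate 2 2 ↭ mset4 a (2 + b) c d
more-twos a b c d = ++-move (replicate a 1) _ (replicate 2 2)

more-threes : ∀ a b c d → mset4 a b c d ++ replicate 3 3 ↭ mset4 a b (3 + c) d
more-threes a b c d = ↭-trans (↭-reflexive (List.++-assoc (replicate a 1) _ _))
  (Perm.++⁺ˡ (replicate a 1) (++-move (replicate b 2) _ (replicate 3 3)))

more-fours : ∀ a b c d → mset4 a b c d ++ replicate 4 4 ↭ mset4 a b c (4 + d)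
more-fours a b c d = ↭-trans (↭-reflexive (List.++-assoc (replicate a 1) _ _))
  (Perm.++⁺ˡ (replicate a 1) (↭-trans (↭-reflexive (List.++-assoc (replicate b 2) _ _))
    (Perm.++⁺ˡ (replicate b 2) (++-move (replicate c 3) _ (replicate 4 4)))))

-- optional cuts and their apartness: a missing cut imposes no condition
OptCut : ℕ → Maybe ℕ → List ℕ → Set
OptCut k m xs = MaybeAll (λ t → Cut k t xs) m

OptApart : ℕ → Maybe ℕ → Maybe ℕ → Set
OptApart k m m' = MaybeAll (λ t → MaybeAll (Apart k t) m') m

module _ {k t : ℕ} (0<k : 0 < k) where

  opt-cut-lift : ∀ {k' m xs} → Cut k t xs → MaybeAll (Apart k t) m → OptCut k' m xs →
    OptCut k' (Maybe.map (lift k t) m) (grow k t xs)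
  opt-cut-lift cut nothing   nothing     = nothing
  opt-cut-lift cut (just ap) (just cut') = just (cut-lift 0<k ap cut cut')

  opt-apart-self : ∀ {m} → MaybeAll (Apart k t) m → MaybeAll (Apart k t) (Maybe.map (lift k t) m)
  opt-apart-self nothing   = nothing
  opt-apart-self (just ap) = just (apart-self 0<k ap)

opt-apart-lift : ∀ {k' m m'} k t → OptApart k' m m' → OptApart k' (Maybe.map (lift k t) m) (Maybe.map (lift k t) m')
opt-apart-lift k t nothing          = nothing
opt-apart-lift k t (just nothing)   = just nothing
opt-apart-lift k t (just (just ap)) = just (just (apart-lift k t ap))

record Growable (a b c d : ℕ) (t₂ t₃ t₄ : Maybe ℕ) : Set where
  field
    walk        : List ℕ
    realization : IsLinearRealization (mset4 a b c d) walk
    cut₂        : OptCut 2 t₂ walk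
    cut₃        : OptCut 3 t₃ walk
    cut₄        : OptCut 4 t₄ walk
    apart₂₃     : OptApart 2 t₂ t₃
    apart₂₄     : OptApart 2 t₂ t₄
    apart₃₄     : OptApart 3 t₃ t₄

open Growable

-- one growth step at each kind of cut; the larger cuts are carried along, the smaller ones dropped
grow₂ : ∀ {a b c d t t₃ t₄} → Growable a b c d (just t) t₃ t₄ →
  Growable a (2 + b) c d (just t) (Maybe.map (lift 2 t) t₃) (Maybe.map (lift 2 t) t₄)
grow₂ {a} {b} {c} {d} {t} g@record { cut₂ = just cut ; apart₂₃ = just ap₃ ; apart₂₄ = just ap₄ } = record
  { walk        = grow 2 _ (walk g)
  ; realization = realization-↭ (more-twos a b c d) (grow-realization cut (realization g))
  ; cut₂        = just (cut-self cut)
  ; cut₃        = opt-cut-lift (s≤s z≤n) cut ap₃ (cut₃ g)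
  ; cut₄        = opt-cut-lift (s≤s z≤n) cut ap₄ (cut₄ g)
  ; apart₂₃     = just (opt-apart-self (s≤s z≤n) ap₃)
  ; apart₂₄     = just (opt-apart-self (s≤s z≤n) ap₄)
  ; apart₃₄     = opt-apart-lift 2 t (apart₃₄ g)
  }

grow₃ : ∀ {a b c d t₂ t t₄} → Growable a b c d t₂ (just t) t₄ →
  Growable a b (3 + c) d nothing (just t) (Maybe.map (lift 3 t) t₄)
grow₃ {a} {b} {c} {d} g@record { cut₃ = just cut ; apart₃₄ = just ap₄ } = record
  { walk        = grow 3 _ (walk g)
  ; realization = realization-↭ (more-threes a b c d) (grow-realization cut (realization g))
  ; cut₂        = nothing
  ; cut₃        = just (cut-self cut)
  ; cut₄        = opt-cut-lift (s≤s z≤n) cut ap₄ (cut₄ g)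
  ; apart₂₃     = nothing
  ; apart₂₄     = nothing
  ; apart₃₄     = just (opt-apart-self (s≤s z≤n) ap₄)
  }

grow₄ : ∀ {a b c d t₂ t₃ t} → Growable a b c d t₂ t₃ (just t) → Growable a b c (4 + d) nothing nothing (just t)
grow₄ {a} {b} {c} {d} g@record { cut₄ = just cut } = record
  { walk        = grow 4 _ (walk g)
  ; realization = realization-↭ (more-fours a b c d) (grow-realization cut (realization g))
  ; cut₂        = nothing
  ; cut₃        = nothing
  ; cut₄        = just (cut-self cut)
  ; apart₂₃     = nothing
  ; apart₂₄     = nothing
  ; apart₃₄     = nothing
  }

Available : Maybe ℕ → ℕ → Set
Available (just _) n = ⊤
Available nothing  n = n ≡ 0

available-map : ∀ {f : ℕ → ℕ} {m n} → Available m n → Available (Maybe.map f m) n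
available-map {m = just _}  _   = tt
available-map {m = nothing} n≡0 = n≡0

-- a certificate that provides the cut whenever the remainder r is at least k
-- allows all i growth steps of the decomposition i * k + r
available : ∀ {m k r i} → (k ≤ r → T (is-just m)) → (i ≡ 0 ⊎ k ≤ r) → Available m i
available {just _}  _    _           = tt
available {nothing} _    (inj₁ i≡0)  = i≡0
available {nothing} need (inj₂ k≤r)  = ⊥-elim (need k≤r)

-- one more step of k; the right side is (suc i) * k + n by evaluation when k is a literal
one-more : ∀ i k n → i * k + (k + n) ≡ k + (i * k + n)
one-more i k n = x∙yz≈y∙xz (i * k) k n

grow-fours : ∀ {a b c d t₂ t₃ t₄} l → Available t₄ l → Growable a b c d t₂ t₃ t₄ →
  HasLinearRealization (mset4 a b c (l * 4 + d))
grow-fours zero _ g = walk g , realization g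
grow-fours {a} {b} {c} {d} {t₄ = just _} (suc l) _ g =
  subst (λ n → HasLinearRealization (mset4 a b c n)) (one-more l 4 d) (grow-fours l tt (grow₄ g))

grow-threes : ∀ {a b c d t₂ t₃ t₄} j l → Available t₃ j → Available t₄ l → Growable a b c d t₂ t₃ t₄ →
  HasLinearRealization (mset4 a b (j * 3 + c) (l * 4 + d))
grow-threes zero l _ av₄ g = grow-fours l av₄ g
grow-threes {a} {b} {c} {d} {t₃ = just _} (suc j) l _ av₄ g =
  subst (λ n → HasLinearRealization (mset4 a b n (l * 4 + d))) (one-more j 3 c)
        (grow-threes j l tt (available-map av₄) (grow₃ g))

grow-twos : ∀ {a b c d t₂ t₃ t₄} i j l → Available t₂ i → Available t₃ j → Available t₄ l →
  Growable a b c d t₂ t₃ t₄ → HasLinearRealization (mset4 a (i * 2 + b) (j * 3 + c) (l * 4 + d))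
grow-twos zero j l _ av₃ av₄ g = grow-threes j l av₃ av₄ g
grow-twos {a} {b} {c} {d} {t₂ = just _} (suc i) j l _ av₃ av₄ g =
  subst (λ n → HasLinearRealization (mset4 a n (j * 3 + c) (l * 4 + d))) (one-more i 2 b)
        (grow-twos i j l tt (available-map av₃) (available-map av₄) (grow₂ g))

split : ∀ k .{{_ : NonZero k}} n → ∃₂ λ i r → n ≡ i * k + r × r < k + k × (i ≡ 0 ⊎ k ≤ r)
split k n with n / k | m≡m%n+[m/n]*n n k
... | zero  | n≡r+0 = 0 , n , refl , n<2k , inj₁ refl
  where
  n<2k : n < k + k
  n<2k = <-≤-trans (subst (_< k) (sym (trans n≡r+0 (+-identityʳ _))) (m%n<n n k)) (m≤m+n k k)
... | suc q | n≡r+k+qk = q , k + n % k , rearranged , +-monoʳ-< k (m%n<n n k) , inj₂ (m≤m+n k (n % k))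
  where
  rearranged : n ≡ q * k + (k + n % k)
  rearranged = trans n≡r+k+qk (trans (+-comm (n % k) (k + q * k))
                 (trans (+-assoc k (q * k) (n % k)) (x∙yz≈y∙xz k (q * k) (n % k))))

remainder-positive : ∀ {k i r} → 0 < k → 0 < i * k + r → (i ≡ 0 ⊎ k ≤ r) → 0 < r
remainder-positive 0<k 0<n (inj₁ refl) = 0<n
remainder-positive 0<k 0<n (inj₂ k≤r)  = <-≤-trans 0<k k≤r

-- Base cases, checked by computation

SameSorted : List ℕ → List ℕ → Set
SameSorted xs ys = sort xs ≡ sort ys

same-sorted? : ∀ xs ys → Dec (SameSorted xs ys)
same-sorted? xs ys = List.≡-dec _≟_ (sort xs) (sort ys)

same-sorted⇒↭ : ∀ {xs ys} → SameSorted xs ys → xs ↭ ys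
same-sorted⇒↭ {xs} {ys} same = ↭-trans (↭-sym (sort-↭ xs)) (subst (_↭ ys) (sym same) (sort-↭ ys))

CheckedCut : ℕ → ℕ → List ℕ → Set
CheckedCut k t xs = k ≤ t × t ≤ length xs × All (Fits k t) (edges xs) × SameSorted (crossings t xs) (window k t)

checked-cut? : ∀ k t xs → Dec (CheckedCut k t xs)
checked-cut? k t xs = k ≤? t ×-dec t ≤? length xs ×-dec all? fits? (edges xs) ×-dec same-sorted? (crossings t xs) (window k t)
  where
  fits? : ∀ e → Dec (Fits k t e)
  fits? e = T? (crosses t e) →-dec len e ≟ k

checked-cut⇒cut : ∀ {k t xs} → CheckedCut k t xs → Cut k t xs
checked-cut⇒cut (k≤t , t≤length , fits , same) =
  record { k≤t = k≤t ; t≤length = t≤length ; fits = fits ; crossings↭ = same-sorted⇒↭ same }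

apart? : ∀ k t t' → Dec (Apart k t t')
apart? k t t' = t' + k ≤? t ⊎-dec t + k ≤? t'

record Certificate : Set where
  constructor certificate
  field
    path   : List ℕ
    at₂ at₃ at₄ : Maybe ℕ

Valid : ℕ → ℕ → ℕ → ℕ → Certificate → Set
Valid a b c d (certificate xs t₂ t₃ t₄) =
  SameSorted xs (upTo (suc (length (mset4 a b c d)))) × SameSorted (diffs xs) (mset4 a b c d) ×
  MaybeAll (λ t → CheckedCut 2 t xs) t₂ × MaybeAll (λ t → CheckedCut 3 t xs) t₃ ×
  MaybeAll (λ t → CheckedCut 4 t xs) t₄ ×
  OptApart 2 t₂ t₃ × OptApart 2 t₂ t₄ × OptApart 3 t₃ t₄ ×
  (2 ≤ b → T (is-just t₂)) × (3 ≤ c → T (is-just t₃)) × (4 ≤ d → T (is-just t₄))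

valid? : ∀ a b c d cert → Dec (Valid a b c d cert)
valid? a b c d (certificate xs t₂ t₃ t₄) =
  same-sorted? xs (upTo (suc (length (mset4 a b c d)))) ×-dec same-sorted? (diffs xs) (mset4 a b c d) ×-dec
  MaybeAll.dec (λ t → checked-cut? 2 t xs) t₂ ×-dec MaybeAll.dec (λ t → checked-cut? 3 t xs) t₃ ×-dec
  MaybeAll.dec (λ t → checked-cut? 4 t xs) t₄ ×-dec
  opt-apart? 2 t₂ t₃ ×-dec opt-apart? 2 t₂ t₄ ×-dec opt-apart? 3 t₃ t₄ ×-dec
  needed? 2 b t₂ ×-dec needed? 3 c t₃ ×-dec needed? 4 d t₄
  where
  opt-apart? : ∀ k m m' → Dec (OptApart k m m')
  opt-apart? k m m' = MaybeAll.dec (λ t → MaybeAll.dec (apart? k t) m') m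
  needed? : ∀ k n (m : Maybe ℕ) → Dec (k ≤ n → T (is-just m))
  needed? k n m = k ≤? n →-dec T? (is-just m)

from-certificate : ∀ {a b c d} cert → Valid a b c d cert →
  Growable a b c d (Certificate.at₂ cert) (Certificate.at₃ cert) (Certificate.at₄ cert) ×
  (2 ≤ b → T (is-just (Certificate.at₂ cert))) × (3 ≤ c → T (is-just (Certificate.at₃ cert))) ×
  (4 ≤ d → T (is-just (Certificate.at₄ cert)))
from-certificate (certificate xs t₂ t₃ t₄) (vertices , lengths , c₂ , c₃ , c₄ , a₂₃ , a₂₄ , a₃₄ , n₂ , n₃ , n₄) =
  record
    { walk        = xs
    ; realization = same-sorted⇒↭ vertices , same-sorted⇒↭ lengths
    ; cut₂        = MaybeAll.map checked-cut⇒cut c₂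
    ; cut₃        = MaybeAll.map checked-cut⇒cut c₃
    ; cut₄        = MaybeAll.map checked-cut⇒cut c₄
    ; apart₂₃     = a₂₃
    ; apart₂₄     = a₂₄
    ; apart₃₄     = a₃₄
    } , n₂ , n₃ , n₄

-- certificates for a ∈ {3, 4}, b < 4, 1 ≤ c ≤ 5 and 1 ≤ d ≤ 7
base : ℕ → ℕ → ℕ → ℕ → Certificate
base 3 0 1 1 = certificate (3 ∷ 4 ∷ 0 ∷ 1 ∷ 2 ∷ 5 ∷ []) nothing nothing nothing
base 3 0 1 2 = certificate (6 ∷ 5 ∷ 1 ∷ 2 ∷ 3 ∷ 0 ∷ 4 ∷ []) nothing nothing nothing
base 3 0 1 3 = certificate (6 ∷ 5 ∷ 1 ∷ 2 ∷ 3 ∷ 7 ∷ 4 ∷ 0 ∷ []) nothing nothing nothing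
base 3 0 1 4 = certificate (0 ∷ 1 ∷ 5 ∷ 8 ∷ 4 ∷ 3 ∷ 7 ∷ 6 ∷ 2 ∷ []) nothing nothing (just 5)
base 3 0 1 5 = certificate (0 ∷ 3 ∷ 7 ∷ 6 ∷ 2 ∷ 1 ∷ 5 ∷ 9 ∷ 8 ∷ 4 ∷ []) nothing nothing (just 5)
base 3 0 1 6 = certificate (6 ∷ 10 ∷ 7 ∷ 3 ∷ 2 ∷ 1 ∷ 5 ∷ 9 ∷ 8 ∷ 4 ∷ 0 ∷ []) nothing nothing (just 7)
base 3 0 1 7 = certificate (6 ∷ 10 ∷ 11 ∷ 7 ∷ 3 ∷ 0 ∷ 4 ∷ 8 ∷ 9 ∷ 5 ∷ 1 ∷ 2 ∷ []) nothing nothing (just 7)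
base 3 0 2 1 = certificate (6 ∷ 2 ∷ 5 ∷ 4 ∷ 3 ∷ 0 ∷ 1 ∷ []) nothing nothing nothing
base 3 0 2 2 = certificate (6 ∷ 5 ∷ 2 ∷ 3 ∷ 7 ∷ 4 ∷ 0 ∷ 1 ∷ []) nothing nothing nothing
base 3 0 2 3 = certificate (6 ∷ 2 ∷ 5 ∷ 1 ∷ 0 ∷ 3 ∷ 4 ∷ 8 ∷ 7 ∷ []) nothing nothing nothing
base 3 0 2 4 = certificate (1 ∷ 5 ∷ 4 ∷ 0 ∷ 3 ∷ 7 ∷ 8 ∷ 9 ∷ 6 ∷ 2 ∷ []) nothing nothing (just 4)
base 3 0 2 5 = certificate (6 ∷ 10 ∷ 7 ∷ 3 ∷ 2 ∷ 5 ∷ 9 ∷ 8 ∷ 4 ∷ 0 ∷ 1 ∷ []) nothing nothing (just 7)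
base 3 0 2 6 = certificate (10 ∷ 6 ∷ 2 ∷ 1 ∷ 0 ∷ 3 ∷ 7 ∷ 11 ∷ 8 ∷ 4 ∷ 5 ∷ 9 ∷ []) nothing nothing (just 8)
base 3 0 2 7 = certificate (10 ∷ 11 ∷ 7 ∷ 3 ∷ 2 ∷ 6 ∷ 9 ∷ 12 ∷ 8 ∷ 4 ∷ 0 ∷ 1 ∷ 5 ∷ []) nothing nothing (just 4)
base 3 0 3 1 = certificate (3 ∷ 6 ∷ 7 ∷ 4 ∷ 0 ∷ 1 ∷ 2 ∷ 5 ∷ []) nothing (just 5) nothing
base 3 0 3 2 = certificate (6 ∷ 3 ∷ 2 ∷ 1 ∷ 5 ∷ 8 ∷ 7 ∷ 4 ∷ 0 ∷ []) nothing (just 6) nothing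
base 3 0 3 3 = certificate (3 ∷ 2 ∷ 6 ∷ 9 ∷ 8 ∷ 5 ∷ 1 ∷ 0 ∷ 4 ∷ 7 ∷ []) nothing (just 7) nothing
base 3 0 3 4 = certificate (4 ∷ 0 ∷ 1 ∷ 5 ∷ 8 ∷ 9 ∷ 6 ∷ 2 ∷ 3 ∷ 7 ∷ 10 ∷ []) nothing (just 8) (just 4)
base 3 0 3 5 = certificate (9 ∷ 6 ∷ 2 ∷ 3 ∷ 7 ∷ 10 ∷ 11 ∷ 8 ∷ 4 ∷ 0 ∷ 1 ∷ 5 ∷ []) nothing (just 9) (just 4)
base 3 0 3 6 = certificate (6 ∷ 2 ∷ 3 ∷ 7 ∷ 10 ∷ 11 ∷ 8 ∷ 4 ∷ 0 ∷ 1 ∷ 5 ∷ 9 ∷ 12 ∷ []) nothing (just 10) (just 4)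
base 3 0 3 7 = certificate (7 ∷ 3 ∷ 2 ∷ 6 ∷ 10 ∷ 13 ∷ 12 ∷ 9 ∷ 5 ∷ 1 ∷ 0 ∷ 4 ∷ 8 ∷ 11 ∷ []) nothing (just 11) (just 6)
base 3 0 4 1 = certificate (6 ∷ 3 ∷ 2 ∷ 5 ∷ 8 ∷ 7 ∷ 4 ∷ 0 ∷ 1 ∷ []) nothing (just 6) nothing
base 3 0 4 2 = certificate (0 ∷ 4 ∷ 7 ∷ 8 ∷ 5 ∷ 1 ∷ 2 ∷ 3 ∷ 6 ∷ 9 ∷ []) nothing (just 6) nothing
base 3 0 4 3 = certificate (0 ∷ 4 ∷ 7 ∷ 10 ∷ 6 ∷ 3 ∷ 2 ∷ 1 ∷ 5 ∷ 8 ∷ 9 ∷ []) nothing (just 6) nothing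
base 3 0 4 4 = certificate (8 ∷ 11 ∷ 10 ∷ 7 ∷ 3 ∷ 0 ∷ 4 ∷ 5 ∷ 1 ∷ 2 ∷ 6 ∷ 9 ∷ []) nothing (just 9) (just 4)
base 3 0 4 5 = certificate (8 ∷ 12 ∷ 11 ∷ 7 ∷ 4 ∷ 0 ∷ 3 ∷ 6 ∷ 10 ∷ 9 ∷ 5 ∷ 2 ∷ 1 ∷ []) nothing (just 5) (just 9)
base 3 0 4 6 = certificate (6 ∷ 2 ∷ 3 ∷ 7 ∷ 10 ∷ 13 ∷ 12 ∷ 9 ∷ 5 ∷ 1 ∷ 0 ∷ 4 ∷ 8 ∷ 11 ∷ []) nothing (just 10) (just 5)
base 3 0 4 7 = certificate (0 ∷ 3 ∷ 6 ∷ 10 ∷ 14 ∷ 13 ∷ 9 ∷ 5 ∷ 2 ∷ 1 ∷ 4 ∷ 8 ∷ 12 ∷ 11 ∷ 7 ∷ []) nothing (just 4) (just 8)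
base 3 0 5 1 = certificate (7 ∷ 4 ∷ 0 ∷ 1 ∷ 2 ∷ 5 ∷ 8 ∷ 9 ∷ 6 ∷ 3 ∷ []) nothing (just 6) nothing
base 3 0 5 2 = certificate (6 ∷ 3 ∷ 0 ∷ 4 ∷ 7 ∷ 10 ∷ 9 ∷ 8 ∷ 5 ∷ 1 ∷ 2 ∷ []) nothing (just 6) nothing
base 3 0 5 3 = certificate (1 ∷ 5 ∷ 8 ∷ 9 ∷ 6 ∷ 2 ∷ 3 ∷ 0 ∷ 4 ∷ 7 ∷ 10 ∷ 11 ∷ []) nothing (just 7) nothing
base 3 0 5 4 = certificate (10 ∷ 7 ∷ 3 ∷ 2 ∷ 6 ∷ 9 ∷ 12 ∷ 11 ∷ 8 ∷ 5 ∷ 1 ∷ 0 ∷ 4 ∷ []) nothing (just 10) (just 4)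
base 3 0 5 5 = certificate (11 ∷ 8 ∷ 4 ∷ 0 ∷ 1 ∷ 2 ∷ 5 ∷ 9 ∷ 12 ∷ 13 ∷ 10 ∷ 6 ∷ 3 ∷ 7 ∷ []) nothing (just 11) (just 7)
base 3 0 5 6 = certificate (14 ∷ 11 ∷ 8 ∷ 4 ∷ 0 ∷ 3 ∷ 7 ∷ 6 ∷ 2 ∷ 1 ∷ 5 ∷ 9 ∷ 12 ∷ 13 ∷ 10 ∷ []) nothing (just 11) (just 4)
base 3 0 5 7 = certificate (10 ∷ 14 ∷ 13 ∷ 9 ∷ 5 ∷ 2 ∷ 1 ∷ 4 ∷ 8 ∷ 12 ∷ 15 ∷ 11 ∷ 7 ∷ 6 ∷ 3 ∷ 0 ∷ []) nothing (just 4) (just 12)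
base 3 1 1 1 = certificate (6 ∷ 5 ∷ 1 ∷ 0 ∷ 3 ∷ 2 ∷ 4 ∷ []) nothing nothing nothing
base 3 1 1 2 = certificate (6 ∷ 3 ∷ 7 ∷ 5 ∷ 4 ∷ 0 ∷ 1 ∷ 2 ∷ []) nothing nothing nothing
base 3 1 1 3 = certificate (6 ∷ 8 ∷ 7 ∷ 3 ∷ 2 ∷ 5 ∷ 1 ∷ 0 ∷ 4 ∷ []) nothing nothing nothing
base 3 1 1 4 = certificate (4 ∷ 0 ∷ 1 ∷ 5 ∷ 7 ∷ 3 ∷ 2 ∷ 6 ∷ 9 ∷ 8 ∷ []) nothing nothing (just 4)
base 3 1 1 5 = certificate (6 ∷ 10 ∷ 7 ∷ 3 ∷ 2 ∷ 0 ∷ 1 ∷ 5 ∷ 9 ∷ 8 ∷ 4 ∷ []) nothing nothing (just 7)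
base 3 1 1 6 = certificate (6 ∷ 10 ∷ 9 ∷ 5 ∷ 1 ∷ 0 ∷ 2 ∷ 3 ∷ 7 ∷ 11 ∷ 8 ∷ 4 ∷ []) nothing nothing (just 7)
base 3 1 1 7 = certificate (12 ∷ 11 ∷ 10 ∷ 6 ∷ 2 ∷ 1 ∷ 5 ∷ 9 ∷ 7 ∷ 3 ∷ 0 ∷ 4 ∷ 8 ∷ []) nothing nothing (just 4)
base 3 1 2 1 = certificate (6 ∷ 3 ∷ 4 ∷ 0 ∷ 1 ∷ 2 ∷ 5 ∷ 7 ∷ []) nothing nothing nothing
base 3 1 2 2 = certificate (6 ∷ 8 ∷ 4 ∷ 5 ∷ 2 ∷ 1 ∷ 0 ∷ 3 ∷ 7 ∷ []) nothing nothing nothing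
base 3 1 2 3 = certificate (6 ∷ 2 ∷ 4 ∷ 1 ∷ 0 ∷ 3 ∷ 7 ∷ 8 ∷ 9 ∷ 5 ∷ []) nothing nothing nothing
base 3 1 2 4 = certificate (6 ∷ 10 ∷ 7 ∷ 3 ∷ 0 ∷ 1 ∷ 2 ∷ 4 ∷ 8 ∷ 9 ∷ 5 ∷ []) nothing nothing (just 7)
base 3 1 2 5 = certificate (6 ∷ 10 ∷ 9 ∷ 5 ∷ 4 ∷ 8 ∷ 11 ∷ 7 ∷ 3 ∷ 0 ∷ 2 ∷ 1 ∷ []) nothing nothing (just 7)
base 3 1 2 6 = certificate (0 ∷ 3 ∷ 5 ∷ 9 ∷ 10 ∷ 6 ∷ 2 ∷ 1 ∷ 4 ∷ 8 ∷ 12 ∷ 11 ∷ 7 ∷ []) nothing nothing (just 8)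
base 3 1 2 7 = certificate (6 ∷ 10 ∷ 13 ∷ 9 ∷ 5 ∷ 4 ∷ 8 ∷ 12 ∷ 11 ∷ 7 ∷ 3 ∷ 0 ∷ 2 ∷ 1 ∷ []) nothing nothing (just 10)
base 3 1 3 1 = certificate (6 ∷ 3 ∷ 4 ∷ 7 ∷ 8 ∷ 5 ∷ 1 ∷ 0 ∷ 2 ∷ []) nothing (just 6) nothing
base 3 1 3 2 = certificate (6 ∷ 3 ∷ 2 ∷ 1 ∷ 5 ∷ 8 ∷ 9 ∷ 7 ∷ 4 ∷ 0 ∷ []) nothing (just 6) nothing
base 3 1 3 3 = certificate (2 ∷ 5 ∷ 7 ∷ 3 ∷ 0 ∷ 1 ∷ 4 ∷ 8 ∷ 9 ∷ 10 ∷ 6 ∷ []) nothing (just 3) nothing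
base 3 1 3 4 = certificate (6 ∷ 10 ∷ 11 ∷ 9 ∷ 5 ∷ 2 ∷ 1 ∷ 4 ∷ 8 ∷ 7 ∷ 3 ∷ 0 ∷ []) nothing (just 3) (just 7)
base 3 1 3 5 = certificate (0 ∷ 3 ∷ 7 ∷ 9 ∷ 5 ∷ 2 ∷ 1 ∷ 4 ∷ 8 ∷ 12 ∷ 11 ∷ 10 ∷ 6 ∷ []) nothing (just 3) (just 7)
base 3 1 3 6 = certificate (13 ∷ 9 ∷ 6 ∷ 2 ∷ 3 ∷ 7 ∷ 10 ∷ 12 ∷ 11 ∷ 8 ∷ 4 ∷ 0 ∷ 1 ∷ 5 ∷ []) nothing (just 9) (just 5)
base 3 1 3 7 = certificate (10 ∷ 13 ∷ 14 ∷ 11 ∷ 7 ∷ 3 ∷ 2 ∷ 6 ∷ 8 ∷ 4 ∷ 0 ∷ 1 ∷ 5 ∷ 9 ∷ 12 ∷ []) nothing (just 12) (just 6)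
base 3 1 4 1 = certificate (6 ∷ 3 ∷ 2 ∷ 5 ∷ 8 ∷ 9 ∷ 7 ∷ 4 ∷ 0 ∷ 1 ∷ []) nothing (just 6) nothing
base 3 1 4 2 = certificate (10 ∷ 7 ∷ 4 ∷ 0 ∷ 1 ∷ 3 ∷ 2 ∷ 6 ∷ 9 ∷ 8 ∷ 5 ∷ []) nothing (just 7) nothing
base 3 1 4 3 = certificate (0 ∷ 3 ∷ 4 ∷ 7 ∷ 11 ∷ 10 ∷ 8 ∷ 5 ∷ 1 ∷ 2 ∷ 6 ∷ 9 ∷ []) nothing (just 7) nothing
base 3 1 4 4 = certificate (7 ∷ 11 ∷ 12 ∷ 10 ∷ 6 ∷ 3 ∷ 0 ∷ 1 ∷ 4 ∷ 8 ∷ 9 ∷ 5 ∷ 2 ∷ []) nothing (just 4) (just 8)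
base 3 1 4 5 = certificate (9 ∷ 13 ∷ 12 ∷ 8 ∷ 5 ∷ 1 ∷ 0 ∷ 3 ∷ 6 ∷ 10 ∷ 11 ∷ 7 ∷ 4 ∷ 2 ∷ []) nothing (just 6) (just 10)
base 3 1 4 6 = certificate (13 ∷ 10 ∷ 11 ∷ 14 ∷ 12 ∷ 9 ∷ 5 ∷ 1 ∷ 2 ∷ 6 ∷ 7 ∷ 3 ∷ 0 ∷ 4 ∷ 8 ∷ []) nothing (just 12) (just 4)
base 3 1 4 7 = certificate (10 ∷ 13 ∷ 14 ∷ 11 ∷ 9 ∷ 5 ∷ 1 ∷ 2 ∷ 6 ∷ 7 ∷ 3 ∷ 0 ∷ 4 ∷ 8 ∷ 12 ∷ 15 ∷ []) nothing (just 13) (just 4)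
base 3 1 5 1 = certificate (10 ∷ 9 ∷ 7 ∷ 6 ∷ 3 ∷ 0 ∷ 1 ∷ 4 ∷ 8 ∷ 5 ∷ 2 ∷ []) nothing (just 3) nothing
base 3 1 5 2 = certificate (11 ∷ 8 ∷ 7 ∷ 4 ∷ 1 ∷ 0 ∷ 2 ∷ 5 ∷ 9 ∷ 10 ∷ 6 ∷ 3 ∷ []) nothing (just 5) nothing
base 3 1 5 3 = certificate (7 ∷ 10 ∷ 12 ∷ 11 ∷ 8 ∷ 4 ∷ 3 ∷ 0 ∷ 1 ∷ 5 ∷ 2 ∷ 6 ∷ 9 ∷ []) nothing (just 9) nothing
base 3 1 5 4 = certificate (1 ∷ 0 ∷ 3 ∷ 6 ∷ 10 ∷ 11 ∷ 7 ∷ 4 ∷ 2 ∷ 5 ∷ 8 ∷ 12 ∷ 13 ∷ 9 ∷ []) nothing (just 6) (just 10)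
base 3 1 5 5 = certificate (5 ∷ 2 ∷ 0 ∷ 3 ∷ 6 ∷ 7 ∷ 11 ∷ 14 ∷ 10 ∷ 9 ∷ 13 ∷ 12 ∷ 8 ∷ 4 ∷ 1 ∷ []) nothing (just 3) (just 11)
base 3 1 5 6 = certificate (9 ∷ 10 ∷ 13 ∷ 14 ∷ 11 ∷ 7 ∷ 3 ∷ 0 ∷ 4 ∷ 6 ∷ 2 ∷ 1 ∷ 5 ∷ 8 ∷ 12 ∷ 15 ∷ []) nothing (just 13) (just 4)
base 3 1 5 7 = certificate (6 ∷ 4 ∷ 1 ∷ 0 ∷ 3 ∷ 7 ∷ 11 ∷ 15 ∷ 14 ∷ 10 ∷ 9 ∷ 13 ∷ 16 ∷ 12 ∷ 8 ∷ 5 ∷ 2 ∷ []) nothing (just 3) (just 13)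
base 3 2 1 1 = certificate (1 ∷ 0 ∷ 4 ∷ 6 ∷ 7 ∷ 5 ∷ 2 ∷ 3 ∷ []) (just 6) nothing nothing
base 3 2 1 2 = certificate (2 ∷ 0 ∷ 1 ∷ 3 ∷ 7 ∷ 6 ∷ 5 ∷ 8 ∷ 4 ∷ []) (just 2) nothing nothing
base 3 2 1 3 = certificate (6 ∷ 8 ∷ 9 ∷ 7 ∷ 3 ∷ 2 ∷ 5 ∷ 1 ∷ 0 ∷ 4 ∷ []) (just 8) nothing nothing
base 3 2 1 4 = certificate (4 ∷ 8 ∷ 10 ∷ 9 ∷ 7 ∷ 3 ∷ 0 ∷ 1 ∷ 5 ∷ 6 ∷ 2 ∷ []) (just 9) nothing (just 5)
base 3 2 1 5 = certificate (4 ∷ 8 ∷ 9 ∷ 5 ∷ 2 ∷ 0 ∷ 1 ∷ 3 ∷ 7 ∷ 11 ∷ 10 ∷ 6 ∷ []) (just 2) nothing (just 8)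
base 3 2 1 6 = certificate (10 ∷ 12 ∷ 11 ∷ 9 ∷ 5 ∷ 1 ∷ 2 ∷ 6 ∷ 7 ∷ 3 ∷ 0 ∷ 4 ∷ 8 ∷ []) (just 11) nothing (just 6)
base 3 2 1 7 = certificate (1 ∷ 2 ∷ 6 ∷ 10 ∷ 12 ∷ 13 ∷ 11 ∷ 7 ∷ 3 ∷ 0 ∷ 4 ∷ 8 ∷ 9 ∷ 5 ∷ []) (just 12) nothing (just 8)
base 3 2 2 1 = certificate (6 ∷ 2 ∷ 0 ∷ 1 ∷ 3 ∷ 4 ∷ 7 ∷ 8 ∷ 5 ∷ []) (just 2) nothing nothing
base 3 2 2 2 = certificate (6 ∷ 8 ∷ 9 ∷ 7 ∷ 4 ∷ 0 ∷ 1 ∷ 5 ∷ 2 ∷ 3 ∷ []) (just 8) nothing nothing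
base 3 2 2 3 = certificate (4 ∷ 7 ∷ 8 ∷ 5 ∷ 9 ∷ 10 ∷ 6 ∷ 2 ∷ 0 ∷ 1 ∷ 3 ∷ []) (just 2) nothing nothing
base 3 2 2 4 = certificate (7 ∷ 11 ∷ 8 ∷ 4 ∷ 2 ∷ 1 ∷ 0 ∷ 3 ∷ 5 ∷ 9 ∷ 10 ∷ 6 ∷ []) (just 4) nothing (just 8)
base 3 2 2 5 = certificate (1 ∷ 2 ∷ 5 ∷ 9 ∷ 11 ∷ 12 ∷ 10 ∷ 6 ∷ 3 ∷ 7 ∷ 8 ∷ 4 ∷ 0 ∷ []) (just 11) nothing (just 7)
base 3 2 2 6 = certificate (11 ∷ 7 ∷ 6 ∷ 10 ∷ 13 ∷ 9 ∷ 5 ∷ 3 ∷ 0 ∷ 1 ∷ 2 ∷ 4 ∷ 8 ∷ 12 ∷ []) (just 4) nothing (just 8)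
base 3 2 2 7 = certificate (0 ∷ 4 ∷ 1 ∷ 5 ∷ 7 ∷ 11 ∷ 14 ∷ 10 ∷ 9 ∷ 13 ∷ 12 ∷ 8 ∷ 6 ∷ 2 ∷ 3 ∷ []) (just 7) nothing (just 11)
base 3 2 3 1 = certificate (2 ∷ 5 ∷ 6 ∷ 8 ∷ 9 ∷ 7 ∷ 3 ∷ 0 ∷ 1 ∷ 4 ∷ []) (just 8) (just 3) nothing
base 3 2 3 2 = certificate (10 ∷ 7 ∷ 3 ∷ 1 ∷ 0 ∷ 2 ∷ 6 ∷ 9 ∷ 8 ∷ 5 ∷ 4 ∷ []) (just 2) (just 8) nothing
base 3 2 3 3 = certificate (3 ∷ 2 ∷ 6 ∷ 9 ∷ 11 ∷ 10 ∷ 8 ∷ 5 ∷ 1 ∷ 0 ∷ 4 ∷ 7 ∷ []) (just 10) (just 7) nothing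
base 3 2 3 4 = certificate (6 ∷ 2 ∷ 0 ∷ 1 ∷ 3 ∷ 7 ∷ 10 ∷ 11 ∷ 8 ∷ 4 ∷ 5 ∷ 9 ∷ 12 ∷ []) (just 2) (just 10) (just 6)
base 3 2 3 5 = certificate (7 ∷ 3 ∷ 1 ∷ 0 ∷ 2 ∷ 6 ∷ 10 ∷ 13 ∷ 12 ∷ 9 ∷ 5 ∷ 4 ∷ 8 ∷ 11 ∷ []) (just 2) (just 11) (just 7)
base 3 2 3 6 = certificate (0 ∷ 3 ∷ 7 ∷ 11 ∷ 13 ∷ 14 ∷ 12 ∷ 8 ∷ 4 ∷ 1 ∷ 2 ∷ 5 ∷ 9 ∷ 10 ∷ 6 ∷ []) (just 13) (just 3) (just 7)
base 3 2 3 7 = certificate (8 ∷ 12 ∷ 13 ∷ 9 ∷ 5 ∷ 2 ∷ 0 ∷ 1 ∷ 3 ∷ 6 ∷ 10 ∷ 14 ∷ 15 ∷ 11 ∷ 7 ∷ 4 ∷ []) (just 2) (just 5) (just 11)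
base 3 2 4 1 = certificate (6 ∷ 3 ∷ 2 ∷ 5 ∷ 8 ∷ 10 ∷ 9 ∷ 7 ∷ 4 ∷ 0 ∷ 1 ∷ []) (just 9) (just 5) nothing
base 3 2 4 2 = certificate (4 ∷ 7 ∷ 11 ∷ 10 ∷ 6 ∷ 3 ∷ 1 ∷ 0 ∷ 2 ∷ 5 ∷ 8 ∷ 9 ∷ []) (just 2) (just 6) nothing
base 3 2 4 3 = certificate (11 ∷ 12 ∷ 8 ∷ 9 ∷ 5 ∷ 2 ∷ 0 ∷ 1 ∷ 3 ∷ 6 ∷ 10 ∷ 7 ∷ 4 ∷ []) (just 2) (just 5) nothing
base 3 2 4 4 = certificate (7 ∷ 11 ∷ 13 ∷ 12 ∷ 10 ∷ 6 ∷ 3 ∷ 0 ∷ 1 ∷ 4 ∷ 8 ∷ 9 ∷ 5 ∷ 2 ∷ []) (just 12) (just 3) (just 8)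
base 3 2 4 5 = certificate (4 ∷ 7 ∷ 11 ∷ 12 ∷ 8 ∷ 5 ∷ 2 ∷ 0 ∷ 1 ∷ 3 ∷ 6 ∷ 10 ∷ 14 ∷ 13 ∷ 9 ∷ []) (just 2) (just 6) (just 11)
base 3 2 4 6 = certificate (11 ∷ 8 ∷ 4 ∷ 0 ∷ 1 ∷ 5 ∷ 9 ∷ 12 ∷ 14 ∷ 15 ∷ 13 ∷ 10 ∷ 7 ∷ 3 ∷ 2 ∷ 6 ∷ []) (just 14) (just 10) (just 6)
base 3 2 4 7 = certificate (0 ∷ 3 ∷ 6 ∷ 10 ∷ 14 ∷ 16 ∷ 15 ∷ 13 ∷ 9 ∷ 5 ∷ 2 ∷ 1 ∷ 4 ∷ 8 ∷ 12 ∷ 11 ∷ 7 ∷ []) (just 15) (just 3) (just 8)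
base 3 2 5 1 = certificate (11 ∷ 8 ∷ 5 ∷ 4 ∷ 7 ∷ 10 ∷ 9 ∷ 6 ∷ 2 ∷ 0 ∷ 1 ∷ 3 ∷ []) (just 2) (just 9) nothing
base 3 2 5 2 = certificate (8 ∷ 7 ∷ 4 ∷ 1 ∷ 0 ∷ 3 ∷ 6 ∷ 10 ∷ 12 ∷ 11 ∷ 9 ∷ 5 ∷ 2 ∷ []) (just 11) (just 4) nothing
base 3 2 5 3 = certificate (11 ∷ 13 ∷ 12 ∷ 10 ∷ 7 ∷ 4 ∷ 0 ∷ 3 ∷ 2 ∷ 6 ∷ 9 ∷ 8 ∷ 5 ∷ 1 ∷ []) (just 12) (just 7) nothing
base 3 2 5 4 = certificate (8 ∷ 11 ∷ 13 ∷ 14 ∷ 12 ∷ 9 ∷ 6 ∷ 2 ∷ 1 ∷ 5 ∷ 4 ∷ 0 ∷ 3 ∷ 7 ∷ 10 ∷ []) (just 13) (just 9) (just 4)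
base 3 2 5 5 = certificate (4 ∷ 0 ∷ 3 ∷ 7 ∷ 10 ∷ 11 ∷ 8 ∷ 5 ∷ 1 ∷ 2 ∷ 6 ∷ 9 ∷ 13 ∷ 15 ∷ 14 ∷ 12 ∷ []) (just 14) (just 9) (just 4)
base 3 2 5 6 = certificate (2 ∷ 0 ∷ 1 ∷ 3 ∷ 6 ∷ 9 ∷ 13 ∷ 16 ∷ 12 ∷ 8 ∷ 5 ∷ 4 ∷ 7 ∷ 11 ∷ 15 ∷ 14 ∷ 10 ∷ []) (just 2) (just 6) (just 12)
base 3 2 5 7 = certificate (13 ∷ 17 ∷ 14 ∷ 10 ∷ 7 ∷ 4 ∷ 8 ∷ 11 ∷ 15 ∷ 16 ∷ 12 ∷ 9 ∷ 5 ∷ 6 ∷ 2 ∷ 0 ∷ 1 ∷ 3 ∷ []) (just 2) (just 10) (just 14)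
base 3 3 1 1 = certificate (0 ∷ 4 ∷ 6 ∷ 7 ∷ 8 ∷ 5 ∷ 3 ∷ 1 ∷ 2 ∷ []) (just 5) nothing nothing
base 3 3 1 2 = certificate (6 ∷ 8 ∷ 9 ∷ 7 ∷ 3 ∷ 1 ∷ 2 ∷ 5 ∷ 4 ∷ 0 ∷ []) (just 8) nothing nothing
base 3 3 1 3 = certificate (3 ∷ 0 ∷ 2 ∷ 6 ∷ 7 ∷ 9 ∷ 10 ∷ 8 ∷ 4 ∷ 5 ∷ 1 ∷ []) (just 9) nothing nothing
base 3 3 1 4 = certificate (0 ∷ 1 ∷ 3 ∷ 5 ∷ 9 ∷ 10 ∷ 6 ∷ 7 ∷ 11 ∷ 8 ∷ 4 ∷ 2 ∷ []) (just 3) nothing (just 8)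
base 3 3 1 5 = certificate (10 ∷ 12 ∷ 11 ∷ 9 ∷ 6 ∷ 2 ∷ 3 ∷ 7 ∷ 5 ∷ 1 ∷ 0 ∷ 4 ∷ 8 ∷ []) (just 11) nothing (just 4)
base 3 3 1 6 = certificate (3 ∷ 1 ∷ 0 ∷ 2 ∷ 4 ∷ 8 ∷ 12 ∷ 11 ∷ 7 ∷ 6 ∷ 10 ∷ 13 ∷ 9 ∷ 5 ∷ []) (just 2) nothing (just 9)
base 3 3 1 7 = certificate (6 ∷ 10 ∷ 12 ∷ 8 ∷ 4 ∷ 5 ∷ 9 ∷ 13 ∷ 14 ∷ 11 ∷ 7 ∷ 3 ∷ 1 ∷ 0 ∷ 2 ∷ []) (just 2) nothing (just 7)
base 3 3 2 1 = certificate (6 ∷ 8 ∷ 9 ∷ 7 ∷ 3 ∷ 0 ∷ 2 ∷ 1 ∷ 4 ∷ 5 ∷ []) (just 8) nothing nothing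
base 3 3 2 2 = certificate (5 ∷ 7 ∷ 10 ∷ 9 ∷ 8 ∷ 6 ∷ 2 ∷ 3 ∷ 1 ∷ 4 ∷ 0 ∷ []) (just 7) nothing nothing
base 3 3 2 3 = certificate (5 ∷ 6 ∷ 2 ∷ 1 ∷ 4 ∷ 0 ∷ 3 ∷ 7 ∷ 9 ∷ 11 ∷ 10 ∷ 8 ∷ []) (just 9) nothing nothing
base 3 3 2 4 = certificate (12 ∷ 10 ∷ 9 ∷ 7 ∷ 3 ∷ 0 ∷ 4 ∷ 5 ∷ 1 ∷ 2 ∷ 6 ∷ 8 ∷ 11 ∷ []) (just 8) nothing (just 4)
base 3 3 2 5 = certificate (12 ∷ 13 ∷ 9 ∷ 7 ∷ 3 ∷ 0 ∷ 4 ∷ 6 ∷ 2 ∷ 1 ∷ 5 ∷ 8 ∷ 10 ∷ 11 ∷ []) (just 9) nothing (just 4)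
base 3 3 2 6 = certificate (5 ∷ 1 ∷ 0 ∷ 4 ∷ 8 ∷ 10 ∷ 14 ∷ 11 ∷ 13 ∷ 12 ∷ 9 ∷ 7 ∷ 3 ∷ 2 ∷ 6 ∷ []) (just 9) nothing (just 5)
base 3 3 2 7 = certificate (1 ∷ 3 ∷ 4 ∷ 5 ∷ 8 ∷ 12 ∷ 15 ∷ 11 ∷ 7 ∷ 9 ∷ 13 ∷ 14 ∷ 10 ∷ 6 ∷ 2 ∷ 0 ∷ []) (just 2) nothing (just 11)
base 3 3 3 1 = certificate (3 ∷ 6 ∷ 8 ∷ 10 ∷ 9 ∷ 7 ∷ 4 ∷ 0 ∷ 1 ∷ 2 ∷ 5 ∷ []) (just 9) (just 5) nothing
base 3 3 3 2 = certificate (3 ∷ 1 ∷ 0 ∷ 2 ∷ 6 ∷ 9 ∷ 10 ∷ 8 ∷ 5 ∷ 4 ∷ 7 ∷ 11 ∷ []) (just 2) (just 7) nothing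
base 3 3 3 3 = certificate (2 ∷ 3 ∷ 6 ∷ 10 ∷ 12 ∷ 11 ∷ 9 ∷ 7 ∷ 4 ∷ 0 ∷ 1 ∷ 5 ∷ 8 ∷ []) (just 11) (just 6) nothing
base 3 3 3 4 = certificate (6 ∷ 10 ∷ 12 ∷ 13 ∷ 11 ∷ 9 ∷ 5 ∷ 2 ∷ 1 ∷ 4 ∷ 8 ∷ 7 ∷ 3 ∷ 0 ∷ []) (just 11) (just 3) (just 7)
base 3 3 3 5 = certificate (12 ∷ 9 ∷ 5 ∷ 6 ∷ 10 ∷ 13 ∷ 14 ∷ 11 ∷ 7 ∷ 3 ∷ 1 ∷ 0 ∷ 2 ∷ 4 ∷ 8 ∷ []) (just 3) (just 12) (just 7)
base 3 3 3 6 = certificate (6 ∷ 10 ∷ 8 ∷ 4 ∷ 1 ∷ 2 ∷ 5 ∷ 9 ∷ 13 ∷ 15 ∷ 14 ∷ 12 ∷ 11 ∷ 7 ∷ 3 ∷ 0 ∷ []) (just 14) (just 3) (just 8)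
base 3 3 3 7 = certificate (14 ∷ 11 ∷ 7 ∷ 3 ∷ 1 ∷ 0 ∷ 2 ∷ 6 ∷ 10 ∷ 13 ∷ 15 ∷ 16 ∷ 12 ∷ 9 ∷ 5 ∷ 4 ∷ 8 ∷ []) (just 2) (just 12) (just 8)
base 3 3 4 1 = certificate (9 ∷ 11 ∷ 10 ∷ 6 ∷ 3 ∷ 1 ∷ 0 ∷ 2 ∷ 5 ∷ 8 ∷ 7 ∷ 4 ∷ []) (just 2) (just 6) nothing
base 3 3 4 2 = certificate (1 ∷ 0 ∷ 4 ∷ 7 ∷ 9 ∷ 11 ∷ 12 ∷ 10 ∷ 6 ∷ 3 ∷ 2 ∷ 5 ∷ 8 ∷ []) (just 11) (just 6) nothing
base 3 3 4 3 = certificate (10 ∷ 11 ∷ 7 ∷ 4 ∷ 2 ∷ 0 ∷ 1 ∷ 3 ∷ 6 ∷ 9 ∷ 13 ∷ 12 ∷ 8 ∷ 5 ∷ []) (just 3) (just 6) nothing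
base 3 3 4 4 = certificate (8 ∷ 11 ∷ 13 ∷ 14 ∷ 12 ∷ 10 ∷ 7 ∷ 3 ∷ 0 ∷ 4 ∷ 5 ∷ 1 ∷ 2 ∷ 6 ∷ 9 ∷ []) (just 13) (just 9) (just 4)
base 3 3 4 5 = certificate (1 ∷ 0 ∷ 3 ∷ 6 ∷ 10 ∷ 11 ∷ 7 ∷ 4 ∷ 2 ∷ 5 ∷ 9 ∷ 13 ∷ 15 ∷ 14 ∷ 12 ∷ 8 ∷ []) (just 14) (just 5) (just 10)
base 3 3 4 6 = certificate (14 ∷ 11 ∷ 8 ∷ 4 ∷ 5 ∷ 9 ∷ 12 ∷ 16 ∷ 15 ∷ 13 ∷ 10 ∷ 6 ∷ 2 ∷ 0 ∷ 1 ∷ 3 ∷ 7 ∷ []) (just 2) (just 12) (just 6)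
base 3 3 4 7 = certificate (4 ∷ 2 ∷ 0 ∷ 1 ∷ 3 ∷ 7 ∷ 10 ∷ 14 ∷ 17 ∷ 13 ∷ 9 ∷ 6 ∷ 5 ∷ 8 ∷ 12 ∷ 16 ∷ 15 ∷ 11 ∷ []) (just 3) (just 8) (just 14)
base 3 3 5 1 = certificate (2 ∷ 5 ∷ 7 ∷ 9 ∷ 12 ∷ 11 ∷ 10 ∷ 8 ∷ 4 ∷ 1 ∷ 0 ∷ 3 ∷ 6 ∷ []) (just 9) (just 4) nothing
base 3 3 5 2 = certificate (9 ∷ 12 ∷ 13 ∷ 10 ∷ 7 ∷ 5 ∷ 1 ∷ 2 ∷ 3 ∷ 0 ∷ 4 ∷ 6 ∷ 8 ∷ 11 ∷ []) (just 7) (just 11) nothing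
base 3 3 5 3 = certificate (3 ∷ 1 ∷ 0 ∷ 4 ∷ 7 ∷ 10 ∷ 11 ∷ 13 ∷ 14 ∷ 12 ∷ 8 ∷ 5 ∷ 2 ∷ 6 ∷ 9 ∷ []) (just 13) (just 7) nothing
base 3 3 5 4 = certificate (12 ∷ 9 ∷ 5 ∷ 4 ∷ 8 ∷ 11 ∷ 14 ∷ 15 ∷ 13 ∷ 10 ∷ 7 ∷ 3 ∷ 1 ∷ 0 ∷ 2 ∷ 6 ∷ []) (just 2) (just 12) (just 6)
base 3 3 5 5 = certificate (16 ∷ 13 ∷ 10 ∷ 6 ∷ 5 ∷ 9 ∷ 12 ∷ 15 ∷ 14 ∷ 11 ∷ 7 ∷ 3 ∷ 1 ∷ 0 ∷ 2 ∷ 4 ∷ 8 ∷ []) (just 2) (just 12) (just 7)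
base 3 3 5 6 = certificate (2 ∷ 5 ∷ 3 ∷ 0 ∷ 1 ∷ 4 ∷ 7 ∷ 9 ∷ 13 ∷ 17 ∷ 14 ∷ 10 ∷ 11 ∷ 15 ∷ 16 ∷ 12 ∷ 8 ∷ 6 ∷ []) (just 8) (just 3) (just 13)
base 3 3 5 7 = certificate (14 ∷ 16 ∷ 18 ∷ 17 ∷ 15 ∷ 11 ∷ 8 ∷ 4 ∷ 0 ∷ 3 ∷ 7 ∷ 10 ∷ 13 ∷ 12 ∷ 9 ∷ 5 ∷ 1 ∷ 2 ∷ 6 ∷ []) (just 16) (just 11) (just 4)
base 4 0 1 1 = certificate (6 ∷ 5 ∷ 4 ∷ 0 ∷ 3 ∷ 2 ∷ 1 ∷ []) nothing nothing nothing
base 4 0 1 2 = certificate (6 ∷ 5 ∷ 2 ∷ 1 ∷ 0 ∷ 4 ∷ 3 ∷ 7 ∷ []) nothing nothing nothing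
base 4 0 1 3 = certificate (6 ∷ 2 ∷ 3 ∷ 0 ∷ 1 ∷ 5 ∷ 4 ∷ 8 ∷ 7 ∷ []) nothing nothing nothing
base 4 0 1 4 = certificate (9 ∷ 5 ∷ 4 ∷ 8 ∷ 7 ∷ 3 ∷ 0 ∷ 1 ∷ 2 ∷ 6 ∷ []) nothing nothing (just 6)
base 4 0 1 5 = certificate (6 ∷ 10 ∷ 7 ∷ 3 ∷ 2 ∷ 1 ∷ 0 ∷ 4 ∷ 8 ∷ 9 ∷ 5 ∷ []) nothing nothing (just 7)
base 4 0 1 6 = certificate (7 ∷ 11 ∷ 10 ∷ 6 ∷ 2 ∷ 1 ∷ 5 ∷ 9 ∷ 8 ∷ 4 ∷ 3 ∷ 0 ∷ []) nothing nothing (just 8)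
base 4 0 1 7 = certificate (12 ∷ 9 ∷ 5 ∷ 1 ∷ 0 ∷ 4 ∷ 8 ∷ 7 ∷ 3 ∷ 2 ∷ 6 ∷ 10 ∷ 11 ∷ []) nothing nothing (just 7)
base 4 0 2 1 = certificate (6 ∷ 5 ∷ 4 ∷ 7 ∷ 3 ∷ 0 ∷ 1 ∷ 2 ∷ []) nothing nothing nothing
base 4 0 2 2 = certificate (6 ∷ 2 ∷ 3 ∷ 4 ∷ 7 ∷ 8 ∷ 5 ∷ 1 ∷ 0 ∷ []) nothing nothing nothing
base 4 0 2 3 = certificate (6 ∷ 9 ∷ 5 ∷ 8 ∷ 7 ∷ 3 ∷ 2 ∷ 1 ∷ 0 ∷ 4 ∷ []) nothing nothing nothing
base 4 0 2 4 = certificate (6 ∷ 10 ∷ 7 ∷ 3 ∷ 4 ∷ 8 ∷ 9 ∷ 5 ∷ 2 ∷ 1 ∷ 0 ∷ []) nothing nothing (just 7)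
base 4 0 2 5 = certificate (0 ∷ 3 ∷ 4 ∷ 8 ∷ 11 ∷ 7 ∷ 6 ∷ 10 ∷ 9 ∷ 5 ∷ 1 ∷ 2 ∷ []) nothing nothing (just 8)
base 4 0 2 6 = certificate (4 ∷ 8 ∷ 12 ∷ 9 ∷ 5 ∷ 6 ∷ 10 ∷ 11 ∷ 7 ∷ 3 ∷ 0 ∷ 1 ∷ 2 ∷ []) nothing nothing (just 7)
base 4 0 2 7 = certificate (2 ∷ 1 ∷ 4 ∷ 8 ∷ 12 ∷ 13 ∷ 9 ∷ 5 ∷ 6 ∷ 10 ∷ 11 ∷ 7 ∷ 3 ∷ 0 ∷ []) nothing nothing (just 9)
base 4 0 3 1 = certificate (6 ∷ 3 ∷ 2 ∷ 1 ∷ 0 ∷ 4 ∷ 7 ∷ 8 ∷ 5 ∷ []) nothing (just 6) nothing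
base 4 0 3 2 = certificate (0 ∷ 4 ∷ 7 ∷ 6 ∷ 3 ∷ 2 ∷ 1 ∷ 5 ∷ 8 ∷ 9 ∷ []) nothing (just 6) nothing
base 4 0 3 3 = certificate (0 ∷ 4 ∷ 7 ∷ 8 ∷ 5 ∷ 1 ∷ 2 ∷ 3 ∷ 6 ∷ 10 ∷ 9 ∷ []) nothing (just 6) nothing
base 4 0 3 4 = certificate (0 ∷ 1 ∷ 4 ∷ 8 ∷ 9 ∷ 5 ∷ 2 ∷ 3 ∷ 6 ∷ 10 ∷ 11 ∷ 7 ∷ []) nothing (just 4) (just 8)
base 4 0 3 5 = certificate (10 ∷ 7 ∷ 3 ∷ 2 ∷ 6 ∷ 5 ∷ 1 ∷ 0 ∷ 4 ∷ 8 ∷ 11 ∷ 12 ∷ 9 ∷ []) nothing (just 10) (just 4)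
base 4 0 3 6 = certificate (13 ∷ 10 ∷ 6 ∷ 2 ∷ 3 ∷ 7 ∷ 8 ∷ 11 ∷ 12 ∷ 9 ∷ 5 ∷ 1 ∷ 0 ∷ 4 ∷ []) nothing (just 11) (just 4)
base 4 0 3 7 = certificate (8 ∷ 12 ∷ 11 ∷ 7 ∷ 4 ∷ 0 ∷ 1 ∷ 2 ∷ 5 ∷ 9 ∷ 13 ∷ 14 ∷ 10 ∷ 6 ∷ 3 ∷ []) nothing (just 5) (just 9)
base 4 0 4 1 = certificate (7 ∷ 4 ∷ 0 ∷ 1 ∷ 2 ∷ 3 ∷ 6 ∷ 9 ∷ 8 ∷ 5 ∷ []) nothing (just 6) nothing
base 4 0 4 2 = certificate (6 ∷ 3 ∷ 2 ∷ 1 ∷ 5 ∷ 8 ∷ 9 ∷ 10 ∷ 7 ∷ 4 ∷ 0 ∷ []) nothing (just 6) nothing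
base 4 0 4 3 = certificate (2 ∷ 3 ∷ 6 ∷ 9 ∷ 10 ∷ 11 ∷ 7 ∷ 4 ∷ 0 ∷ 1 ∷ 5 ∷ 8 ∷ []) nothing (just 6) nothing
base 4 0 4 4 = certificate (6 ∷ 10 ∷ 11 ∷ 7 ∷ 8 ∷ 12 ∷ 9 ∷ 5 ∷ 2 ∷ 1 ∷ 4 ∷ 3 ∷ 0 ∷ []) nothing (just 3) (just 9)
base 4 0 4 5 = certificate (9 ∷ 13 ∷ 10 ∷ 6 ∷ 3 ∷ 2 ∷ 1 ∷ 0 ∷ 4 ∷ 7 ∷ 11 ∷ 12 ∷ 8 ∷ 5 ∷ []) nothing (just 6) (just 10)
base 4 0 4 6 = certificate (4 ∷ 0 ∷ 1 ∷ 5 ∷ 8 ∷ 9 ∷ 12 ∷ 13 ∷ 10 ∷ 6 ∷ 2 ∷ 3 ∷ 7 ∷ 11 ∷ 14 ∷ []) nothing (just 12) (just 4)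
base 4 0 4 7 = certificate (15 ∷ 12 ∷ 9 ∷ 5 ∷ 1 ∷ 0 ∷ 4 ∷ 8 ∷ 7 ∷ 3 ∷ 2 ∷ 6 ∷ 10 ∷ 13 ∷ 14 ∷ 11 ∷ []) nothing (just 12) (just 7)
base 4 0 5 1 = certificate (6 ∷ 3 ∷ 2 ∷ 5 ∷ 8 ∷ 9 ∷ 10 ∷ 7 ∷ 4 ∷ 0 ∷ 1 ∷ []) nothing (just 6) nothing
base 4 0 5 2 = certificate (10 ∷ 9 ∷ 6 ∷ 2 ∷ 1 ∷ 0 ∷ 3 ∷ 4 ∷ 7 ∷ 11 ∷ 8 ∷ 5 ∷ []) nothing (just 7) nothing
base 4 0 5 3 = certificate (12 ∷ 11 ∷ 8 ∷ 5 ∷ 1 ∷ 0 ∷ 4 ∷ 7 ∷ 10 ∷ 9 ∷ 6 ∷ 2 ∷ 3 ∷ []) nothing (just 9) nothing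
base 4 0 5 4 = certificate (6 ∷ 2 ∷ 1 ∷ 0 ∷ 3 ∷ 7 ∷ 10 ∷ 13 ∷ 12 ∷ 9 ∷ 5 ∷ 4 ∷ 8 ∷ 11 ∷ []) nothing (just 11) (just 6)
base 4 0 5 5 = certificate (5 ∷ 2 ∷ 1 ∷ 4 ∷ 7 ∷ 11 ∷ 12 ∷ 8 ∷ 9 ∷ 13 ∷ 14 ∷ 10 ∷ 6 ∷ 3 ∷ 0 ∷ []) nothing (just 3) (just 10)
base 4 0 5 6 = certificate (9 ∷ 12 ∷ 15 ∷ 11 ∷ 8 ∷ 4 ∷ 0 ∷ 1 ∷ 5 ∷ 6 ∷ 2 ∷ 3 ∷ 7 ∷ 10 ∷ 13 ∷ 14 ∷ []) nothing (just 11) (just 5)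
base 4 0 5 7 = certificate (12 ∷ 9 ∷ 6 ∷ 2 ∷ 3 ∷ 7 ∷ 10 ∷ 14 ∷ 13 ∷ 16 ∷ 15 ∷ 11 ∷ 8 ∷ 4 ∷ 0 ∷ 1 ∷ 5 ∷ []) nothing (just 9) (just 5)
base 4 1 1 1 = certificate (6 ∷ 3 ∷ 2 ∷ 1 ∷ 0 ∷ 4 ∷ 5 ∷ 7 ∷ []) nothing nothing nothing
base 4 1 1 2 = certificate (6 ∷ 8 ∷ 5 ∷ 4 ∷ 0 ∷ 1 ∷ 2 ∷ 3 ∷ 7 ∷ []) nothing nothing nothing
base 4 1 1 3 = certificate (6 ∷ 2 ∷ 4 ∷ 3 ∷ 0 ∷ 1 ∷ 5 ∷ 9 ∷ 8 ∷ 7 ∷ []) nothing nothing nothing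
base 4 1 1 4 = certificate (6 ∷ 10 ∷ 9 ∷ 5 ∷ 4 ∷ 8 ∷ 7 ∷ 3 ∷ 0 ∷ 2 ∷ 1 ∷ []) nothing nothing (just 7)
base 4 1 1 5 = certificate (6 ∷ 10 ∷ 9 ∷ 5 ∷ 4 ∷ 8 ∷ 11 ∷ 7 ∷ 3 ∷ 2 ∷ 0 ∷ 1 ∷ []) nothing nothing (just 7)
base 4 1 1 6 = certificate (5 ∷ 9 ∷ 12 ∷ 11 ∷ 7 ∷ 3 ∷ 4 ∷ 8 ∷ 10 ∷ 6 ∷ 2 ∷ 1 ∷ 0 ∷ []) nothing nothing (just 6)
base 4 1 1 7 = certificate (6 ∷ 10 ∷ 13 ∷ 9 ∷ 8 ∷ 12 ∷ 11 ∷ 7 ∷ 3 ∷ 2 ∷ 0 ∷ 4 ∷ 5 ∷ 1 ∷ []) nothing nothing (just 10)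
base 4 1 2 1 = certificate (6 ∷ 8 ∷ 5 ∷ 4 ∷ 7 ∷ 3 ∷ 2 ∷ 1 ∷ 0 ∷ []) nothing nothing nothing
base 4 1 2 2 = certificate (6 ∷ 2 ∷ 3 ∷ 4 ∷ 7 ∷ 9 ∷ 8 ∷ 5 ∷ 1 ∷ 0 ∷ []) nothing nothing nothing
base 4 1 2 3 = certificate (6 ∷ 10 ∷ 7 ∷ 4 ∷ 0 ∷ 1 ∷ 2 ∷ 3 ∷ 5 ∷ 9 ∷ 8 ∷ []) nothing nothing nothing
base 4 1 2 4 = certificate (9 ∷ 10 ∷ 11 ∷ 8 ∷ 5 ∷ 1 ∷ 0 ∷ 4 ∷ 6 ∷ 2 ∷ 3 ∷ 7 ∷ []) nothing nothing (just 4)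
base 4 1 2 5 = certificate (0 ∷ 3 ∷ 4 ∷ 6 ∷ 10 ∷ 11 ∷ 7 ∷ 8 ∷ 12 ∷ 9 ∷ 5 ∷ 1 ∷ 2 ∷ []) nothing nothing (just 9)
base 4 1 2 6 = certificate (6 ∷ 10 ∷ 13 ∷ 9 ∷ 5 ∷ 4 ∷ 2 ∷ 1 ∷ 0 ∷ 3 ∷ 7 ∷ 11 ∷ 12 ∷ 8 ∷ []) nothing nothing (just 10)
base 4 1 2 7 = certificate (12 ∷ 14 ∷ 13 ∷ 9 ∷ 8 ∷ 5 ∷ 1 ∷ 2 ∷ 6 ∷ 10 ∷ 11 ∷ 7 ∷ 3 ∷ 0 ∷ 4 ∷ []) nothing nothing (just 4)
base 4 1 3 1 = certificate (6 ∷ 3 ∷ 2 ∷ 1 ∷ 0 ∷ 4 ∷ 7 ∷ 9 ∷ 8 ∷ 5 ∷ []) nothing (just 6) nothing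
base 4 1 3 2 = certificate (8 ∷ 9 ∷ 10 ∷ 6 ∷ 3 ∷ 2 ∷ 5 ∷ 7 ∷ 4 ∷ 0 ∷ 1 ∷ []) nothing (just 5) nothing
base 4 1 3 3 = certificate (11 ∷ 10 ∷ 6 ∷ 3 ∷ 2 ∷ 1 ∷ 5 ∷ 8 ∷ 9 ∷ 7 ∷ 4 ∷ 0 ∷ []) nothing (just 6) nothing
base 4 1 3 4 = certificate (7 ∷ 11 ∷ 12 ∷ 8 ∷ 6 ∷ 10 ∷ 9 ∷ 5 ∷ 2 ∷ 1 ∷ 4 ∷ 3 ∷ 0 ∷ []) nothing (just 3) (just 9)
base 4 1 3 5 = certificate (4 ∷ 7 ∷ 11 ∷ 10 ∷ 6 ∷ 3 ∷ 2 ∷ 0 ∷ 1 ∷ 5 ∷ 8 ∷ 12 ∷ 13 ∷ 9 ∷ []) nothing (just 6) (just 10)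
base 4 1 3 6 = certificate (10 ∷ 14 ∷ 13 ∷ 9 ∷ 5 ∷ 2 ∷ 0 ∷ 1 ∷ 4 ∷ 8 ∷ 12 ∷ 11 ∷ 7 ∷ 6 ∷ 3 ∷ []) nothing (just 4) (just 11)
base 4 1 3 7 = certificate (3 ∷ 0 ∷ 1 ∷ 4 ∷ 6 ∷ 10 ∷ 14 ∷ 15 ∷ 11 ∷ 7 ∷ 8 ∷ 12 ∷ 13 ∷ 9 ∷ 5 ∷ 2 ∷ []) nothing (just 3) (just 12)
base 4 1 4 1 = certificate (2 ∷ 0 ∷ 1 ∷ 5 ∷ 8 ∷ 7 ∷ 4 ∷ 3 ∷ 6 ∷ 9 ∷ 10 ∷ []) nothing (just 7) nothing
base 4 1 4 2 = certificate (0 ∷ 1 ∷ 4 ∷ 8 ∷ 5 ∷ 2 ∷ 3 ∷ 6 ∷ 7 ∷ 11 ∷ 9 ∷ 10 ∷ []) nothing (just 4) nothing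
base 4 1 4 3 = certificate (12 ∷ 11 ∷ 10 ∷ 7 ∷ 3 ∷ 5 ∷ 8 ∷ 9 ∷ 6 ∷ 2 ∷ 1 ∷ 4 ∷ 0 ∷ []) nothing (just 8) nothing
base 4 1 4 4 = certificate (6 ∷ 2 ∷ 1 ∷ 5 ∷ 4 ∷ 0 ∷ 3 ∷ 7 ∷ 8 ∷ 11 ∷ 13 ∷ 10 ∷ 9 ∷ 12 ∷ []) nothing (just 11) (just 4)
base 4 1 4 5 = certificate (3 ∷ 0 ∷ 2 ∷ 5 ∷ 9 ∷ 10 ∷ 6 ∷ 7 ∷ 11 ∷ 14 ∷ 13 ∷ 12 ∷ 8 ∷ 4 ∷ 1 ∷ []) nothing (just 3) (just 8)
base 4 1 4 6 = certificate (13 ∷ 12 ∷ 15 ∷ 14 ∷ 10 ∷ 7 ∷ 3 ∷ 2 ∷ 6 ∷ 9 ∷ 11 ∷ 8 ∷ 4 ∷ 0 ∷ 1 ∷ 5 ∷ []) nothing (just 9) (just 4)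
base 4 1 4 7 = certificate (2 ∷ 1 ∷ 0 ∷ 4 ∷ 7 ∷ 11 ∷ 15 ∷ 16 ∷ 12 ∷ 8 ∷ 5 ∷ 3 ∷ 6 ∷ 9 ∷ 13 ∷ 14 ∷ 10 ∷ []) nothing (just 6) (just 11)
base 4 1 5 1 = certificate (1 ∷ 0 ∷ 2 ∷ 5 ∷ 8 ∷ 9 ∷ 6 ∷ 3 ∷ 4 ∷ 7 ∷ 11 ∷ 10 ∷ []) nothing (just 7) nothing
base 4 1 5 2 = certificate (1 ∷ 0 ∷ 2 ∷ 6 ∷ 9 ∷ 12 ∷ 11 ∷ 8 ∷ 5 ∷ 4 ∷ 3 ∷ 7 ∷ 10 ∷ []) nothing (just 9) nothing
base 4 1 5 3 = certificate (10 ∷ 8 ∷ 5 ∷ 2 ∷ 3 ∷ 6 ∷ 9 ∷ 13 ∷ 12 ∷ 11 ∷ 7 ∷ 4 ∷ 0 ∷ 1 ∷ []) nothing (just 5) nothing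
base 4 1 5 4 = certificate (0 ∷ 3 ∷ 4 ∷ 1 ∷ 2 ∷ 5 ∷ 8 ∷ 12 ∷ 14 ∷ 13 ∷ 9 ∷ 6 ∷ 10 ∷ 11 ∷ 7 ∷ []) nothing (just 3) (just 10)
base 4 1 5 5 = certificate (8 ∷ 4 ∷ 2 ∷ 1 ∷ 0 ∷ 3 ∷ 7 ∷ 11 ∷ 14 ∷ 13 ∷ 10 ∷ 6 ∷ 5 ∷ 9 ∷ 12 ∷ 15 ∷ []) nothing (just 13) (just 7)
base 4 1 5 6 = certificate (1 ∷ 0 ∷ 2 ∷ 3 ∷ 6 ∷ 9 ∷ 13 ∷ 16 ∷ 12 ∷ 8 ∷ 5 ∷ 4 ∷ 7 ∷ 11 ∷ 15 ∷ 14 ∷ 10 ∷ []) nothing (just 7) (just 12)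
base 4 1 5 7 = certificate (1 ∷ 0 ∷ 3 ∷ 2 ∷ 5 ∷ 8 ∷ 12 ∷ 16 ∷ 17 ∷ 13 ∷ 9 ∷ 6 ∷ 4 ∷ 7 ∷ 11 ∷ 15 ∷ 14 ∷ 10 ∷ []) nothing (just 7) (just 14)
base 4 2 1 1 = certificate (6 ∷ 4 ∷ 0 ∷ 1 ∷ 2 ∷ 3 ∷ 5 ∷ 8 ∷ 7 ∷ []) (just 5) nothing nothing
base 4 2 1 2 = certificate (6 ∷ 8 ∷ 9 ∷ 7 ∷ 3 ∷ 2 ∷ 5 ∷ 4 ∷ 0 ∷ 1 ∷ []) (just 8) nothing nothing
base 4 2 1 3 = certificate (8 ∷ 6 ∷ 2 ∷ 3 ∷ 4 ∷ 0 ∷ 1 ∷ 5 ∷ 7 ∷ 10 ∷ 9 ∷ []) (just 7) nothing nothing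
base 4 2 1 4 = certificate (11 ∷ 7 ∷ 6 ∷ 10 ∷ 9 ∷ 5 ∷ 2 ∷ 0 ∷ 1 ∷ 3 ∷ 4 ∷ 8 ∷ []) (just 2) nothing (just 8)
base 4 2 1 5 = certificate (12 ∷ 8 ∷ 6 ∷ 2 ∷ 1 ∷ 5 ∷ 4 ∷ 0 ∷ 3 ∷ 7 ∷ 9 ∷ 10 ∷ 11 ∷ []) (just 8) nothing (just 4)
base 4 2 1 6 = certificate (10 ∷ 6 ∷ 7 ∷ 11 ∷ 12 ∷ 8 ∷ 4 ∷ 2 ∷ 1 ∷ 0 ∷ 3 ∷ 5 ∷ 9 ∷ 13 ∷ []) (just 4) nothing (just 10)
base 4 2 1 7 = certificate (14 ∷ 10 ∷ 6 ∷ 4 ∷ 0 ∷ 3 ∷ 2 ∷ 1 ∷ 5 ∷ 7 ∷ 11 ∷ 12 ∷ 8 ∷ 9 ∷ 13 ∷ []) (just 6) nothing (just 11)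
base 4 2 2 1 = certificate (6 ∷ 8 ∷ 9 ∷ 7 ∷ 4 ∷ 3 ∷ 2 ∷ 5 ∷ 1 ∷ 0 ∷ []) (just 8) nothing nothing
base 4 2 2 2 = certificate (2 ∷ 0 ∷ 1 ∷ 3 ∷ 6 ∷ 10 ∷ 7 ∷ 8 ∷ 9 ∷ 5 ∷ 4 ∷ []) (just 2) nothing nothing
base 4 2 2 3 = certificate (6 ∷ 8 ∷ 11 ∷ 10 ∷ 9 ∷ 7 ∷ 3 ∷ 2 ∷ 5 ∷ 1 ∷ 0 ∷ 4 ∷ []) (just 8) nothing nothing
base 4 2 2 4 = certificate (12 ∷ 11 ∷ 8 ∷ 6 ∷ 2 ∷ 1 ∷ 5 ∷ 4 ∷ 0 ∷ 3 ∷ 7 ∷ 9 ∷ 10 ∷ []) (just 8) nothing (just 4)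
base 4 2 2 5 = certificate (0 ∷ 3 ∷ 7 ∷ 6 ∷ 2 ∷ 1 ∷ 5 ∷ 9 ∷ 11 ∷ 12 ∷ 13 ∷ 10 ∷ 8 ∷ 4 ∷ []) (just 10) nothing (just 6)
base 4 2 2 6 = certificate (14 ∷ 13 ∷ 10 ∷ 8 ∷ 4 ∷ 0 ∷ 3 ∷ 7 ∷ 6 ∷ 2 ∷ 1 ∷ 5 ∷ 9 ∷ 11 ∷ 12 ∷ []) (just 10) nothing (just 5)
base 4 2 2 7 = certificate (9 ∷ 8 ∷ 4 ∷ 0 ∷ 3 ∷ 7 ∷ 11 ∷ 13 ∷ 14 ∷ 15 ∷ 12 ∷ 10 ∷ 6 ∷ 2 ∷ 1 ∷ 5 ∷ []) (just 12) nothing (just 4)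
base 4 2 3 1 = certificate (3 ∷ 6 ∷ 5 ∷ 2 ∷ 1 ∷ 0 ∷ 4 ∷ 7 ∷ 9 ∷ 10 ∷ 8 ∷ []) (just 9) (just 5) nothing
base 4 2 3 2 = certificate (9 ∷ 8 ∷ 5 ∷ 4 ∷ 7 ∷ 11 ∷ 10 ∷ 6 ∷ 3 ∷ 1 ∷ 0 ∷ 2 ∷ []) (just 2) (just 6) nothing
base 4 2 3 3 = certificate (9 ∷ 6 ∷ 2 ∷ 0 ∷ 1 ∷ 3 ∷ 7 ∷ 10 ∷ 11 ∷ 12 ∷ 8 ∷ 5 ∷ 4 ∷ []) (just 2) (just 8) nothing
base 4 2 3 4 = certificate (0 ∷ 1 ∷ 4 ∷ 8 ∷ 9 ∷ 5 ∷ 2 ∷ 3 ∷ 6 ∷ 10 ∷ 12 ∷ 13 ∷ 11 ∷ 7 ∷ []) (just 12) (just 4) (just 8)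
base 4 2 3 5 = certificate (11 ∷ 14 ∷ 13 ∷ 10 ∷ 8 ∷ 4 ∷ 0 ∷ 1 ∷ 5 ∷ 6 ∷ 2 ∷ 3 ∷ 7 ∷ 9 ∷ 12 ∷ []) (just 9) (just 12) (just 4)
base 4 2 3 6 = certificate (4 ∷ 5 ∷ 8 ∷ 12 ∷ 13 ∷ 9 ∷ 6 ∷ 2 ∷ 0 ∷ 1 ∷ 3 ∷ 7 ∷ 10 ∷ 14 ∷ 15 ∷ 11 ∷ []) (just 2) (just 8) (just 12)
base 4 2 3 7 = certificate (2 ∷ 5 ∷ 7 ∷ 11 ∷ 15 ∷ 16 ∷ 12 ∷ 8 ∷ 9 ∷ 13 ∷ 14 ∷ 10 ∷ 6 ∷ 4 ∷ 1 ∷ 0 ∷ 3 ∷ []) (just 6) (just 3) (just 10)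
base 4 2 4 1 = certificate (0 ∷ 3 ∷ 6 ∷ 8 ∷ 9 ∷ 10 ∷ 11 ∷ 7 ∷ 5 ∷ 2 ∷ 1 ∷ 4 ∷ []) (just 7) (just 4) nothing
base 4 2 4 2 = certificate (6 ∷ 7 ∷ 10 ∷ 11 ∷ 8 ∷ 4 ∷ 3 ∷ 1 ∷ 0 ∷ 2 ∷ 5 ∷ 9 ∷ 12 ∷ []) (just 2) (just 10) nothing
base 4 2 4 3 = certificate (6 ∷ 7 ∷ 3 ∷ 0 ∷ 1 ∷ 4 ∷ 8 ∷ 11 ∷ 13 ∷ 12 ∷ 10 ∷ 9 ∷ 5 ∷ 2 ∷ []) (just 12) (just 3) nothing
base 4 2 4 4 = certificate (8 ∷ 4 ∷ 2 ∷ 1 ∷ 0 ∷ 3 ∷ 5 ∷ 9 ∷ 12 ∷ 13 ∷ 10 ∷ 6 ∷ 7 ∷ 11 ∷ 14 ∷ []) (just 4) (just 12) (just 8)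
base 4 2 4 5 = certificate (5 ∷ 1 ∷ 0 ∷ 4 ∷ 8 ∷ 11 ∷ 10 ∷ 7 ∷ 3 ∷ 2 ∷ 6 ∷ 9 ∷ 12 ∷ 14 ∷ 15 ∷ 13 ∷ []) (just 14) (just 10) (just 5)
base 4 2 4 6 = certificate (0 ∷ 3 ∷ 7 ∷ 9 ∷ 13 ∷ 16 ∷ 12 ∷ 11 ∷ 15 ∷ 14 ∷ 10 ∷ 8 ∷ 4 ∷ 1 ∷ 2 ∷ 5 ∷ 6 ∷ []) (just 9) (just 3) (just 13)
base 4 2 4 7 = certificate (17 ∷ 14 ∷ 11 ∷ 9 ∷ 5 ∷ 1 ∷ 0 ∷ 4 ∷ 8 ∷ 7 ∷ 3 ∷ 2 ∷ 6 ∷ 10 ∷ 12 ∷ 15 ∷ 16 ∷ 13 ∷ []) (just 11) (just 15) (just 7)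
base 4 2 5 1 = certificate (12 ∷ 9 ∷ 6 ∷ 4 ∷ 0 ∷ 1 ∷ 2 ∷ 3 ∷ 5 ∷ 8 ∷ 11 ∷ 10 ∷ 7 ∷ []) (just 5) (just 9) nothing
base 4 2 5 2 = certificate (2 ∷ 3 ∷ 6 ∷ 9 ∷ 11 ∷ 12 ∷ 13 ∷ 10 ∷ 8 ∷ 5 ∷ 1 ∷ 0 ∷ 4 ∷ 7 ∷ []) (just 10) (just 7) nothing
base 4 2 5 3 = certificate (9 ∷ 8 ∷ 12 ∷ 14 ∷ 13 ∷ 11 ∷ 7 ∷ 10 ∷ 6 ∷ 3 ∷ 0 ∷ 1 ∷ 4 ∷ 5 ∷ 2 ∷ []) (just 13) (just 3) nothing
base 4 2 5 4 = certificate (11 ∷ 8 ∷ 6 ∷ 2 ∷ 1 ∷ 5 ∷ 4 ∷ 0 ∷ 3 ∷ 7 ∷ 9 ∷ 12 ∷ 15 ∷ 14 ∷ 13 ∷ 10 ∷ []) (just 8) (just 11) (just 4)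
base 4 2 5 5 = certificate (0 ∷ 3 ∷ 6 ∷ 8 ∷ 12 ∷ 16 ∷ 15 ∷ 11 ∷ 10 ∷ 14 ∷ 13 ∷ 9 ∷ 7 ∷ 4 ∷ 1 ∷ 2 ∷ 5 ∷ []) (just 8) (just 3) (just 12)
base 4 2 5 6 = certificate (15 ∷ 17 ∷ 16 ∷ 14 ∷ 13 ∷ 10 ∷ 7 ∷ 3 ∷ 0 ∷ 4 ∷ 8 ∷ 11 ∷ 12 ∷ 9 ∷ 5 ∷ 1 ∷ 2 ∷ 6 ∷ []) (just 16) (just 11) (just 4)
base 4 2 5 7 = certificate (2 ∷ 1 ∷ 5 ∷ 8 ∷ 10 ∷ 14 ∷ 18 ∷ 17 ∷ 13 ∷ 12 ∷ 16 ∷ 15 ∷ 11 ∷ 9 ∷ 6 ∷ 3 ∷ 0 ∷ 4 ∷ 7 ∷ []) (just 10) (just 6) (just 14)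
base 4 3 1 1 = certificate (6 ∷ 8 ∷ 9 ∷ 7 ∷ 3 ∷ 0 ∷ 1 ∷ 2 ∷ 4 ∷ 5 ∷ []) (just 8) nothing nothing
base 4 3 1 2 = certificate (6 ∷ 8 ∷ 10 ∷ 9 ∷ 7 ∷ 3 ∷ 4 ∷ 0 ∷ 1 ∷ 2 ∷ 5 ∷ []) (just 8) nothing nothing
base 4 3 1 3 = certificate (0 ∷ 2 ∷ 3 ∷ 4 ∷ 6 ∷ 10 ∷ 9 ∷ 8 ∷ 11 ∷ 7 ∷ 5 ∷ 1 ∷ []) (just 6) nothing nothing
base 4 3 1 4 = certificate (3 ∷ 7 ∷ 9 ∷ 12 ∷ 11 ∷ 10 ∷ 8 ∷ 4 ∷ 2 ∷ 6 ∷ 5 ∷ 1 ∷ 0 ∷ []) (just 9) nothing (just 5)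
base 4 3 1 5 = certificate (1 ∷ 5 ∷ 9 ∷ 10 ∷ 12 ∷ 13 ∷ 11 ∷ 8 ∷ 4 ∷ 3 ∷ 7 ∷ 6 ∷ 2 ∷ 0 ∷ []) (just 12) nothing (just 6)
base 4 3 1 6 = certificate (3 ∷ 7 ∷ 9 ∷ 12 ∷ 11 ∷ 13 ∷ 14 ∷ 10 ∷ 8 ∷ 4 ∷ 0 ∷ 1 ∷ 5 ∷ 6 ∷ 2 ∷ []) (just 9) nothing (just 4)
base 4 3 1 7 = certificate (1 ∷ 5 ∷ 9 ∷ 10 ∷ 11 ∷ 13 ∷ 15 ∷ 14 ∷ 12 ∷ 8 ∷ 4 ∷ 0 ∷ 3 ∷ 7 ∷ 6 ∷ 2 ∷ []) (just 14) nothing (just 6)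
base 4 3 2 1 = certificate (4 ∷ 0 ∷ 1 ∷ 3 ∷ 2 ∷ 5 ∷ 7 ∷ 10 ∷ 9 ∷ 8 ∷ 6 ∷ []) (just 7) nothing nothing
base 4 3 2 2 = certificate (9 ∷ 10 ∷ 6 ∷ 4 ∷ 1 ∷ 0 ∷ 2 ∷ 3 ∷ 5 ∷ 8 ∷ 7 ∷ 11 ∷ []) (just 5) nothing nothing
base 4 3 2 3 = certificate (3 ∷ 5 ∷ 2 ∷ 6 ∷ 7 ∷ 9 ∷ 12 ∷ 11 ∷ 10 ∷ 8 ∷ 4 ∷ 0 ∷ 1 ∷ []) (just 9) nothing nothing
base 4 3 2 4 = certificate (13 ∷ 12 ∷ 10 ∷ 8 ∷ 7 ∷ 3 ∷ 0 ∷ 4 ∷ 5 ∷ 1 ∷ 2 ∷ 6 ∷ 9 ∷ 11 ∷ []) (just 10) nothing (just 4)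
base 4 3 2 5 = certificate (3 ∷ 1 ∷ 0 ∷ 2 ∷ 4 ∷ 7 ∷ 11 ∷ 12 ∷ 8 ∷ 5 ∷ 6 ∷ 10 ∷ 14 ∷ 13 ∷ 9 ∷ []) (just 3) nothing (just 11)
base 4 3 2 6 = certificate (2 ∷ 6 ∷ 8 ∷ 12 ∷ 15 ∷ 14 ∷ 10 ∷ 9 ∷ 13 ∷ 11 ∷ 7 ∷ 5 ∷ 1 ∷ 0 ∷ 3 ∷ 4 ∷ []) (just 7) nothing (just 11)
base 4 3 2 7 = certificate (1 ∷ 2 ∷ 0 ∷ 4 ∷ 5 ∷ 7 ∷ 11 ∷ 15 ∷ 14 ∷ 10 ∷ 9 ∷ 13 ∷ 16 ∷ 12 ∷ 8 ∷ 6 ∷ 3 ∷ []) (just 7) nothing (just 11)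
base 4 3 3 1 = certificate (4 ∷ 1 ∷ 0 ∷ 2 ∷ 5 ∷ 7 ∷ 11 ∷ 10 ∷ 9 ∷ 8 ∷ 6 ∷ 3 ∷ []) (just 7) (just 4) nothing
base 4 3 3 2 = certificate (6 ∷ 2 ∷ 0 ∷ 1 ∷ 3 ∷ 4 ∷ 5 ∷ 9 ∷ 12 ∷ 10 ∷ 7 ∷ 8 ∷ 11 ∷ []) (just 2) (just 10) nothing
base 4 3 3 3 = certificate (6 ∷ 8 ∷ 12 ∷ 13 ∷ 9 ∷ 10 ∷ 11 ∷ 7 ∷ 5 ∷ 2 ∷ 0 ∷ 3 ∷ 4 ∷ 1 ∷ []) (just 7) (just 3) nothing
base 4 3 3 4 = certificate (5 ∷ 1 ∷ 0 ∷ 2 ∷ 6 ∷ 9 ∷ 10 ∷ 7 ∷ 3 ∷ 4 ∷ 8 ∷ 11 ∷ 13 ∷ 14 ∷ 12 ∷ []) (just 13) (just 9) (just 5)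
base 4 3 3 5 = certificate (11 ∷ 15 ∷ 14 ∷ 10 ∷ 7 ∷ 3 ∷ 1 ∷ 0 ∷ 2 ∷ 4 ∷ 5 ∷ 8 ∷ 12 ∷ 13 ∷ 9 ∷ 6 ∷ []) (just 3) (just 8) (just 12)
base 4 3 3 6 = certificate (15 ∷ 16 ∷ 12 ∷ 9 ∷ 5 ∷ 6 ∷ 10 ∷ 13 ∷ 14 ∷ 11 ∷ 7 ∷ 3 ∷ 1 ∷ 0 ∷ 2 ∷ 4 ∷ 8 ∷ []) (just 3) (just 12) (just 7)
base 4 3 3 7 = certificate (6 ∷ 10 ∷ 12 ∷ 16 ∷ 17 ∷ 13 ∷ 14 ∷ 15 ∷ 11 ∷ 9 ∷ 5 ∷ 2 ∷ 0 ∷ 3 ∷ 7 ∷ 8 ∷ 4 ∷ 1 ∷ []) (just 11) (just 3) (just 7)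
base 4 3 4 1 = certificate (7 ∷ 10 ∷ 11 ∷ 12 ∷ 8 ∷ 5 ∷ 3 ∷ 2 ∷ 0 ∷ 1 ∷ 4 ∷ 6 ∷ 9 ∷ []) (just 5) (just 8) nothing
base 4 3 4 2 = certificate (9 ∷ 11 ∷ 13 ∷ 12 ∷ 10 ∷ 6 ∷ 3 ∷ 2 ∷ 5 ∷ 8 ∷ 7 ∷ 4 ∷ 0 ∷ 1 ∷ []) (just 12) (just 6) nothing
base 4 3 4 3 = certificate (12 ∷ 9 ∷ 7 ∷ 11 ∷ 14 ∷ 13 ∷ 10 ∷ 6 ∷ 5 ∷ 3 ∷ 0 ∷ 1 ∷ 2 ∷ 4 ∷ 8 ∷ []) (just 4) (just 12) nothing
base 4 3 4 4 = certificate (9 ∷ 5 ∷ 2 ∷ 0 ∷ 1 ∷ 3 ∷ 7 ∷ 8 ∷ 4 ∷ 6 ∷ 10 ∷ 13 ∷ 14 ∷ 11 ∷ 12 ∷ 15 ∷ []) (just 2) (just 13) (just 7)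
base 4 3 4 5 = certificate (10 ∷ 6 ∷ 4 ∷ 8 ∷ 9 ∷ 5 ∷ 2 ∷ 0 ∷ 1 ∷ 3 ∷ 7 ∷ 11 ∷ 14 ∷ 15 ∷ 12 ∷ 13 ∷ 16 ∷ []) (just 2) (just 14) (just 7)
base 4 3 4 6 = certificate (17 ∷ 15 ∷ 16 ∷ 12 ∷ 9 ∷ 5 ∷ 4 ∷ 8 ∷ 11 ∷ 14 ∷ 13 ∷ 10 ∷ 6 ∷ 2 ∷ 0 ∷ 1 ∷ 3 ∷ 7 ∷ []) (just 2) (just 11) (just 7)
base 4 3 4 7 = certificate (17 ∷ 14 ∷ 11 ∷ 9 ∷ 5 ∷ 1 ∷ 0 ∷ 4 ∷ 8 ∷ 7 ∷ 3 ∷ 2 ∷ 6 ∷ 10 ∷ 12 ∷ 13 ∷ 16 ∷ 18 ∷ 15 ∷ []) (just 11) (just 16) (just 7)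
base 4 3 5 1 = certificate (5 ∷ 2 ∷ 1 ∷ 4 ∷ 8 ∷ 10 ∷ 13 ∷ 12 ∷ 11 ∷ 9 ∷ 7 ∷ 6 ∷ 3 ∷ 0 ∷ []) (just 10) (just 4) nothing
base 4 3 5 2 = certificate (7 ∷ 11 ∷ 13 ∷ 14 ∷ 12 ∷ 10 ∷ 6 ∷ 9 ∷ 8 ∷ 5 ∷ 2 ∷ 1 ∷ 4 ∷ 3 ∷ 0 ∷ []) (just 12) (just 3) nothing
base 4 3 5 3 = certificate (9 ∷ 11 ∷ 13 ∷ 14 ∷ 15 ∷ 12 ∷ 10 ∷ 6 ∷ 3 ∷ 0 ∷ 4 ∷ 7 ∷ 8 ∷ 5 ∷ 1 ∷ 2 ∷ []) (just 11) (just 6) nothing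
base 4 3 5 4 = certificate (10 ∷ 14 ∷ 15 ∷ 11 ∷ 12 ∷ 16 ∷ 13 ∷ 9 ∷ 6 ∷ 3 ∷ 1 ∷ 0 ∷ 2 ∷ 4 ∷ 7 ∷ 8 ∷ 5 ∷ []) (just 3) (just 6) (just 13)
base 4 3 5 5 = certificate (17 ∷ 16 ∷ 13 ∷ 10 ∷ 12 ∷ 15 ∷ 14 ∷ 11 ∷ 7 ∷ 3 ∷ 1 ∷ 0 ∷ 2 ∷ 6 ∷ 9 ∷ 5 ∷ 4 ∷ 8 ∷ []) (just 2) (just 14) (just 6)
base 4 3 5 6 = certificate (7 ∷ 4 ∷ 0 ∷ 1 ∷ 3 ∷ 6 ∷ 10 ∷ 12 ∷ 16 ∷ 17 ∷ 13 ∷ 14 ∷ 18 ∷ 15 ∷ 11 ∷ 9 ∷ 8 ∷ 5 ∷ 2 ∷ []) (just 11) (just 5) (just 15)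
base 4 3 5 7 = certificate (2 ∷ 5 ∷ 7 ∷ 11 ∷ 15 ∷ 18 ∷ 17 ∷ 19 ∷ 16 ∷ 12 ∷ 8 ∷ 9 ∷ 13 ∷ 14 ∷ 10 ∷ 6 ∷ 4 ∷ 1 ∷ 0 ∷ 3 ∷ []) (just 6) (just 3) (just 13)
base _ _ _ _ = certificate [] nothing nothing nothing

all-valid : All (λ a → All (λ b → All (λ c → All (λ d → Valid a b c d (base a b c d))
              (applyUpTo suc 7)) (applyUpTo suc 5)) (upTo 4)) (3 ∷ 4 ∷ [])
all-valid = toWitness {a? = all? (λ a → all? (λ b → all? (λ c → all? (λ d → valid? a b c d (base a b c d))
              (applyUpTo suc 7)) (applyUpTo suc 5)) (upTo 4)) (3 ∷ 4 ∷ [])} tt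

∈-positive : ∀ {r n} → 0 < r → r < suc n → r ∈ applyUpTo suc n
∈-positive {suc r} _ (s≤s r<n) = ∈-applyUpTo⁺ suc r<n

base-valid : ∀ {a b c d} → a ∈ 3 ∷ 4 ∷ [] → b ∈ upTo 4 → c ∈ applyUpTo suc 5 → d ∈ applyUpTo suc 7 →
  Valid a b c d (base a b c d)
base-valid a∈ b∈ c∈ d∈ = All.lookup (All.lookup (All.lookup (All.lookup all-valid a∈) b∈) c∈) d∈

realizable : ∀ {a} → a ∈ 3 ∷ 4 ∷ [] → ∀ b c d → 0 < c → 0 < d → HasLinearRealization (mset4 a b c d)
realizable {a} a∈ b c d 0<c 0<d with split 2 b | split 3 c | split 4 d
... | i , r₂ , refl , r₂<4 , s₂ | j , r₃ , refl , r₃<6 , s₃ | l , r₄ , refl , r₄<8 , s₄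
  = let growable , need₂ , need₃ , need₄ = from-certificate {a} _ (base-valid a∈ (∈-upTo⁺ r₂<4)
                 (∈-positive (remainder-positive (s≤s z≤n) 0<c s₃) r₃<6)
                 (∈-positive (remainder-positive (s≤s z≤n) 0<d s₄) r₄<8))
    in grow-twos {a} i j l (available need₂ s₂) (available need₃ s₃) (available need₄ s₄) growable

proposition5p6 : (c d : ℕ) → c ≥ 1 → d ≥ 1 → (b : ℕ) →
    HasLinearRealization (mset4 3 b c d) × HasLinearRealization (mset4 4 b c d)
proposition5p6 c d c≥1 d≥1 b = realizable (here refl) b c d c≥1 d≥1 , realizable (there (here refl)) b c d c≥1 d≥1
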